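{- For every integer $n\geq 2$, the number of spanning quasi-trees of the bouquet $\mathbb{F}'^{1}_n$ is $\kappa(\mathbb{F}'^{1}_n)=f_n+\ell_{n-1}$.
   Context: A bouquet is a ribbon graph (surface with boundary made of vertex discs and edge ribbons) with exactly one vertex. A quasi-tree is a ribbon graph with exactly one boundary component; $\kappa(G)$ is the number of $F\subseteq E(G)$ such that the spanning ribbon subgraph $(V(G),F)$ (delete edges outside $F$) is a quasi-tree. A bouquet with edges $1,\dots,n$ is given by a signed rotation: a cyclic sequence in which each label occurs twice, recording the order in which the edge ends meet the vertex boundary; occurrences may carry a minus sign (plus omitted), and edge $i$ is an orientable loop iff its two occurrences have the same sign, a non-orientable loop (forming a Möbius band with the vertex) otherwise. $\mathbb{F}'^{1}_2$ has signed rotation $(-1,2,2,1)$; for $n\geq3$, $\mathbb{F}'^{1}_n$ has signed rotation $-1,2,3,2,1$, followed by $i,i-1$ for $i=4,\dots,n$, followed by $n$, i.e. $(-1,2,3,2,1,4,3,5,4,\dots,n,n-1,n)$; it is obtained from the bouquet $\mathbb{F}'_n$ (same rotation without the minus sign) by adding a half-twist to edge $1$. Fibonacci numbers: $f_1=f_2=1$, $f_k=f_{k-1}+f_{k-2}$; Lucas numbers: $\ell_1=1,\ell_2=3$, $\ell_k=\ell_{k-1}+\ell_{k-2}$. -}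

module Defs where

open import Data.Bool using (Bool; true; false; if_then_else_; _∧_; not)
open import Data.Nat using (ℕ; zero; suc; _+_; _*_; _∸_; _≤ᵇ_; _≡ᵇ_; _%_)
open import Data.List using (List; []; _∷_; _++_; length; map; filter; concatMap; upTo; foldr)
open import Data.Product using (_×_; _,_; proj₁; proj₂)
open import Data.Nat using (_≟_; _/_)

-- Signed rotations of bouquets.
-- An end is (sign , label); sign true = "+", false = "-".
-- A bouquet on edges 1..n is given by a cyclic list in which each label
-- of 1..n occurs exactly twice.

End : Set
End = Bool × ℕ

Rotation : Set
Rotation = List End

nth : {A : Set} → A → List A → ℕ → A
nth d []       _       = d
nth d (x ∷ xs) zero    = x
nth d (x ∷ xs) (suc k) = nth d xs k

partner : Rotation → ℕ → ℕ
partner ρ p = go ρ 0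
  where
    lab : ℕ
    lab = proj₂ (nth (true , 0) ρ p)
    go : Rotation → ℕ → ℕ
    go []            _ = p
    go ((_ , l) ∷ r) q = if (l ≡ᵇ lab) ∧ not (q ≡ᵇ p) then q else go r (suc q)

-- Each end at position p (0 ≤ p < L, L = length of the rotation) has two
-- boundary points on the vertex disc: its left corner 2p (before it in
-- the cyclic order) and its right corner 2p+1 (after it).
-- The boundary of the ribbon graph is made of
--   * vertex arcs: from the right corner of p to the left corner of p+1
--     (cyclically), and
--   * edge sides: for an edge with ends at p and q, an untwisted edge
--     (same signs) joins left(p)–right(q) and right(p)–left(q), a twisted
--     edge (opposite signs) joins left(p)–left(q) and right(p)–right(q).
-- Boundary components are the cycles of the resulting 2-regular graph.

-- All functions below take L = suc m (a nonempty rotation).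
-- Points are encoded as natural numbers 0 .. 2L-1.

arcStep : ℕ → ℕ → ℕ
arcStep m x with x % 2
... | zero  = 2 * ((x / 2 + m) % suc m) + 1
... | suc _ = 2 * ((x / 2 + 1) % suc m)

sameSign : Bool → Bool → Bool
sameSign true  true  = true
sameSign false false = true
sameSign _     _     = false

edgeStep : Rotation → ℕ → ℕ
edgeStep ρ x with x % 2
... | zero  = if sameSign (proj₁ (nth (true , 0) ρ p)) (proj₁ (nth (true , 0) ρ q))
                then 2 * q + 1 else 2 * q
  where p = x / 2
        q = partner ρ p
... | suc _ = if sameSign (proj₁ (nth (true , 0) ρ p)) (proj₁ (nth (true , 0) ρ q))
                then 2 * q else 2 * q + 1
  where p = x / 2
        q = partner ρ p

walk : Rotation → ℕ → ℕ → ℕ → ℕ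
walk ρ m x zero    = x
walk ρ m x (suc k) = let y = walk ρ m x k in
  if k % 2 ≡ᵇ 0 then arcStep m y else edgeStep ρ y

-- x is the least point of its boundary component
-- (a boundary cycle has at most 2L points, so 2L steps traverse it)
allB : {A : Set} → (A → Bool) → List A → Bool
allB P = foldr (λ a b → P a ∧ b) true

isLeast : Rotation → ℕ → ℕ → Bool
isLeast ρ m x = allB (λ k → x ≤ᵇ walk ρ m x k) (upTo (2 * suc m))

count : {A : Set} → (A → Bool) → List A → ℕ
count P xs = length (filter (λ a → P a Data.Bool.≟ true) xs)
  where import Data.Bool

-- number of boundary components of the bouquet with signed rotation ρ;
-- the bouquet with no edges is a disc, with one boundary component
boundaryComponents : Rotation → ℕ
boundaryComponents []          = 1
boundaryComponents ρ@(_ ∷ ρ') = count (isLeast ρ (length ρ')) (upTo (2 * length ρ))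

-- Spanning ribbon subgraphs and quasi-trees.
-- A subset F of the edge set {1,...,n} is a list of n Booleans
-- (entry i-1 says whether edge i ∈ F).

subsets : ℕ → List (List Bool)
subsets zero    = [] ∷ []
subsets (suc n) = map (true ∷_) (subsets n) ++ map (false ∷_) (subsets n)

inSubset : List Bool → ℕ → Bool
inSubset F zero    = false
inSubset F (suc i) = nth false F i

-- the spanning sub-bouquet (V, F): delete the edges outside F, i.e. their ends
restrict : List Bool → Rotation → Rotation
restrict F = filter (λ e → inSubset F (proj₂ e) Data.Bool.≟ true)
  where import Data.Bool

isQuasiTree : Rotation → Bool
isQuasiTree ρ = boundaryComponents ρ ≡ᵇ 1

κ : ℕ → Rotation → ℕ
κ n ρ = count (λ F → isQuasiTree (restrict F ρ)) (subsets n)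

pos neg : ℕ → End
pos i = (true , i)
neg i = (false , i)

middle : ℕ → Rotation
middle n = concatMap (λ j → pos (j + 4) ∷ pos (j + 3) ∷ []) (upTo (n ∸ 3))

F'1 : ℕ → Rotation
F'1 2 = neg 1 ∷ pos 2 ∷ pos 2 ∷ pos 1 ∷ []
F'1 n = (neg 1 ∷ pos 2 ∷ pos 3 ∷ pos 2 ∷ pos 1 ∷ []) ++ middle n ++ (pos n ∷ [])

-- Fibonacci and Lucas numbers (f₀ = 0, ℓ₀ = 2 extend the given recursions)

fib : ℕ → ℕ
fib 0 = 0
fib 1 = 1
fib (suc (suc k)) = fib (suc k) + fib k

lucas : ℕ → ℕ
lucas 0 = 2
lucas 1 = 1
lucas (suc (suc k)) = lucas (suc k) + lucas k

-- Split the edge sets F of F'1 (n + 2) by the last two edges. If n + 2 ∉ F, the sub-bouquet is one of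
-- F'1 (n + 1). If n + 2 ∈ F but n + 1 ∉ F, it is a sub-bouquet of F'1 n followed by the trivial loop
-- (n + 2) (n + 2), which splits off a boundary component, so it is never a quasi-tree. If both lie in F,
-- it arises from a sub-bouquet P Z of F'1 n as P (n + 1) Z (n + 2) (n + 1) (n + 2), which has as many
-- boundary components as P Z. Hence κ (F'1 (n + 2)) = κ (F'1 (n + 1)) + κ (F'1 n), the recurrence of
-- f n + ℓ (n - 1), and the cases n = 2, 3 are computed.
--
-- Boundary components are the orbits of the corners under two perfect matchings, the vertex arcs and
-- the edge sides, each counted at its least corner. Both moves are compared with the old bouquet by
-- embedding the old corners monotonically and retracting every new corner to a smaller corner of its
-- orbit; this preserves the least corners of old orbits and creates no new ones except on detached
-- components.

module Submission where

open import Defs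
open import Data.Bool using (Bool; true; false; if_then_else_; _∧_; _∨_; not; T)
import Data.Bool as Bool
open import Data.Bool.Properties using (T-≡; ⇔→≡)
open import Data.Empty using (⊥; ⊥-elim)
open import Data.Fin using (toℕ; fromℕ<)
import Data.Fin.Properties as Fin
open import Data.List using (List; []; _∷_; _++_; length; map; filter; concatMap; upTo; applyUpTo)
open import Data.List.Membership.Propositional using (_∈_)
open import Data.List.Membership.Propositional.Properties using (∈-++⁺ʳ)
open import Data.List.Properties using (length-++; ++-assoc; ++-identityʳ; filter-++; concatMap-++; applyUpTo-∷ʳ)
open import Data.List.Relation.Unary.All using (All; []; _∷_)
import Data.List.Relation.Unary.All as All
open import Data.List.Relation.Unary.All.Properties using (++⁺; filter⁺)
import Data.List.Relation.Unary.Any as Any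
open import Data.Nat
open import Data.Nat.DivMod
open import Data.Nat.Properties
open import Data.Nat.Tactic.RingSolver using (solve-∀)
open import Data.Product using (Σ; _×_; _,_; proj₁; proj₂)
open import Data.Sum using (_⊎_; inj₁; inj₂)
open import Data.Unit using (⊤; tt)
open import Function using (_∘_)
open import Function.Bundles using (Equivalence; mk⇔)
open import Relation.Binary using (tri<; tri≈; tri>)
open import Relation.Binary.PropositionalEquality
open import Relation.Nullary using (yes; no)

T⇒≡true : ∀ {b} → T b → b ≡ true
T⇒≡true = Equivalence.to T-≡

≡true⇒T : ∀ {b} → b ≡ true → T b
≡true⇒T = Equivalence.from T-≡

≡ᵇ≡true⇒≡ : ∀ {m n} → (m ≡ᵇ n) ≡ true → m ≡ n
≡ᵇ≡true⇒≡ {m} {n} eq = ≡ᵇ⇒≡ m n (≡true⇒T eq)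

≡⇒≡ᵇ≡true : ∀ {m n} → m ≡ n → (m ≡ᵇ n) ≡ true
≡⇒≡ᵇ≡true {m} {n} m≡n with m ≡ᵇ n in eq
... | true  = refl
... | false = ⊥-elim (subst T eq (≡⇒≡ᵇ m n m≡n))

≢⇒≡ᵇ≡false : ∀ {m n} → m ≢ n → (m ≡ᵇ n) ≡ false
≢⇒≡ᵇ≡false {m} {n} m≢n with m ≡ᵇ n in eq
... | true  = ⊥-elim (m≢n (≡ᵇ≡true⇒≡ eq))
... | false = refl

≡ᵇ≡false⇒≢ : ∀ {m n} → (m ≡ᵇ n) ≡ false → m ≢ n
≡ᵇ≡false⇒≢ eq m≡n with () ← trans (sym (≡⇒≡ᵇ≡true m≡n)) eq

if-< : ∀ {A : Set} {m n} (a b : A) → m < n → (if m <ᵇ n then a else b) ≡ a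
if-< {m = m} {n} a b m<n with m <ᵇ n in eq
... | true  = refl
... | false = ⊥-elim (subst T eq (<⇒<ᵇ m<n))

if-≥ : ∀ {A : Set} {m n} (a b : A) → n ≤ m → (if m <ᵇ n then a else b) ≡ b
if-≥ {m = m} {n} a b n≤m with m <ᵇ n in eq
... | true  = ⊥-elim (<⇒≱ (<ᵇ⇒< m n (≡true⇒T eq)) n≤m)
... | false = refl

2p%2≡0 : ∀ p → 2 * p % 2 ≡ 0
2p%2≡0 p = trans (cong (_% 2) (*-comm 2 p)) (m*n%n≡0 p 2)

2p/2≡p : ∀ p → 2 * p / 2 ≡ p
2p/2≡p p = trans (cong (_/ 2) (*-comm 2 p)) (m*n/n≡m p 2)

[2p+1]%2≡1 : ∀ p → (2 * p + 1) % 2 ≡ 1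
[2p+1]%2≡1 p = trans (cong (_% 2) (trans (+-comm (2 * p) 1) (cong (1 +_) (*-comm 2 p))))
                     ([m+kn]%n≡m%n 1 p 2)

[2p+1]/2≡p : ∀ p → (2 * p + 1) / 2 ≡ p
[2p+1]/2≡p p = trans (+-distrib-/ (2 * p) 1 (subst (λ r → r + 1 < 2) (sym (2p%2≡0 p)) ≤-refl))
                     (trans (cong (_+ 0) (2p/2≡p p)) (+-identityʳ p))

data Corner : ℕ → Set where
  left  : ∀ p → Corner (2 * p)
  right : ∀ p → Corner (2 * p + 1)

corner : ∀ x → Corner x
corner zero          = left 0
corner (suc zero)    = right 0
corner (suc (suc x)) with corner x
... | left p  = subst Corner (*-suc 2 p) (left (suc p))
... | right p = subst Corner (cong (_+ 1) (*-suc 2 p)) (right (suc p))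

left≢right : ∀ p q → 2 * p ≢ 2 * q + 1
left≢right p q eq with () ← trans (sym (2p%2≡0 p)) (trans (cong (_% 2) eq) ([2p+1]%2≡1 q))

left-injective : ∀ {p q} → 2 * p ≡ 2 * q → p ≡ q
left-injective {p} {q} = *-cancelˡ-≡ p q 2

right-injective : ∀ {p q} → 2 * p + 1 ≡ 2 * q + 1 → p ≡ q
right-injective {p} {q} eq = left-injective (+-cancelʳ-≡ 1 (2 * p) (2 * q) eq)

left-< : ∀ {p n} → p < n → 2 * p < 2 * n
left-< = *-monoʳ-< 2

right-< : ∀ {p n} → p < n → 2 * p + 1 < 2 * n
right-< {p} {n} p<n =
  subst (_≤ 2 * n) (trans (*-suc 2 p) (cong suc (+-comm 1 (2 * p)))) (*-monoʳ-≤ 2 {suc p} {n} p<n)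

left-<⁻ : ∀ {p} n → 2 * p < 2 * n → p < n
left-<⁻ {p} n = *-cancelˡ-< 2 p n

right-<⁻ : ∀ {p} n → 2 * p + 1 < 2 * n → p < n
right-<⁻ {p} n lt = left-<⁻ n (≤-trans (n≤1+n _) (subst (_< 2 * n) (+-comm (2 * p) 1) lt))

left-≤ : ∀ {p q} → p ≤ q → 2 * p ≤ 2 * q
left-≤ = *-monoʳ-≤ 2

arcStep-left : ∀ m p → arcStep m (2 * p) ≡ 2 * ((p + m) % suc m) + 1
arcStep-left m p rewrite 2p%2≡0 p | 2p/2≡p p = refl

arcStep-right : ∀ m p → arcStep m (2 * p + 1) ≡ 2 * ((p + 1) % suc m)
arcStep-right m p rewrite [2p+1]%2≡1 p | [2p+1]/2≡p p = refl

arcStep-first : ∀ m → arcStep m 0 ≡ 2 * m + 1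
arcStep-first m = trans (arcStep-left m 0) (cong (λ r → 2 * r + 1) (m≤n⇒m%n≡m {m} ≤-refl))

arcStep-left-suc : ∀ m p → p < suc m → arcStep m (2 * suc p) ≡ 2 * p + 1
arcStep-left-suc m p p≤m = trans (arcStep-left m (suc p)) (cong (λ r → 2 * r + 1) p+m+1%m+1≡p)
  where
  p+m+1%m+1≡p : (suc p + m) % suc m ≡ p
  p+m+1%m+1≡p = trans (cong (_% suc m) (sym (+-suc p m)))
                      (trans ([m+n]%n≡m%n p (suc m)) (m<n⇒m%n≡m p≤m))

arcStep-right-< : ∀ m p → p < m → arcStep m (2 * p + 1) ≡ 2 * suc p
arcStep-right-< m p p<m = trans (arcStep-right m p)
  (cong (2 *_) (trans (cong (_% suc m) (+-comm p 1)) (m<n⇒m%n≡m (s≤s p<m))))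

arcStep-last : ∀ m → arcStep m (2 * m + 1) ≡ 0
arcStep-last m = trans (arcStep-right m m)
  (cong (2 *_) (trans (cong (_% suc m) (+-comm m 1)) (n%n≡0 (suc m))))

arcStep-interior : ∀ m M x → m ≤ M → x < 2 * suc m → x ≢ 0 → x ≢ 2 * m + 1 → arcStep M x ≡ arcStep m x
arcStep-interior m M x m≤M x< x≢0 x≢last with corner x
... | left zero    = ⊥-elim (x≢0 refl)
... | left (suc p) = trans (arcStep-left-suc M p (≤-trans p<m (s≤s m≤M))) (sym (arcStep-left-suc m p p<m))
  where p<m = <-trans (n<1+n p) (left-<⁻ (suc m) x<)
... | right p with m≤n⇒m<n∨m≡n {p} {m} (s≤s⁻¹ (right-<⁻ (suc m) x<))
...   | inj₂ refl = ⊥-elim (x≢last refl)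
...   | inj₁ p<m  = trans (arcStep-right-< M p (≤-trans p<m m≤M)) (sym (arcStep-right-< m p p<m))

nth-++ˡ : ∀ {A : Set} (d : A) xs ys k → k < length xs → nth d (xs ++ ys) k ≡ nth d xs k
nth-++ˡ d (x ∷ xs) ys zero    _         = refl
nth-++ˡ d (x ∷ xs) ys (suc k) (s≤s k<) = nth-++ˡ d xs ys k k<

nth-++ʳ : ∀ {A : Set} (d : A) xs ys k → nth d (xs ++ ys) (length xs + k) ≡ nth d ys k
nth-++ʳ d []       ys k = refl
nth-++ʳ d (x ∷ xs) ys k = nth-++ʳ d xs ys k

signAt : Rotation → ℕ → Bool
signAt ρ p = proj₁ (nth (true , 0) ρ p)

labelAt : Rotation → ℕ → ℕ
labelAt ρ p = proj₂ (nth (true , 0) ρ p)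

untwisted : Rotation → ℕ → Bool
untwisted ρ p = sameSign (signAt ρ p) (signAt ρ (partner ρ p))

edgeStep-left : ∀ ρ p → edgeStep ρ (2 * p) ≡
  (if untwisted ρ p then 2 * partner ρ p + 1 else 2 * partner ρ p)
edgeStep-left ρ p rewrite 2p%2≡0 p | 2p/2≡p p = refl

edgeStep-right : ∀ ρ p → edgeStep ρ (2 * p + 1) ≡
  (if untwisted ρ p then 2 * partner ρ p else 2 * partner ρ p + 1)
edgeStep-right ρ p rewrite [2p+1]%2≡1 p | [2p+1]/2≡p p = refl

search : ℕ → ℕ → Rotation → ℕ → ℕ
search l p []             k = p
search l p ((_ , l') ∷ r) k = if (l' ≡ᵇ l) ∧ not (k ≡ᵇ p) then k else search l p r (suc k)

-- The search scans r, whose first end sits at position k of the rotation.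
record FirstHit (l p : ℕ) (r : Rotation) (k i : ℕ) : Set where
  field
    bound    : i < length r
    distinct : k + i ≢ p
    hit      : labelAt r i ≡ l
    first    : ∀ j → j < i → k + j ≢ p → labelAt r j ≢ l

private
  miss : ∀ {l l' k p} → ((l' ≡ᵇ l) ∧ not (k ≡ᵇ p)) ≡ false → k ≢ p → l' ≢ l
  miss {l} {l'} {k} {p} test k≢p l'≡l
    rewrite ≡⇒≡ᵇ≡true l'≡l | ≢⇒≡ᵇ≡false k≢p with () ← test

  FirstHit-tail : ∀ {l p s l' r k i} → FirstHit l p ((s , l') ∷ r) k (suc i) → FirstHit l p r (suc k) i
  FirstHit-tail {k = k} {i} h = record
    { bound    = s≤s⁻¹ bound
    ; distinct = λ eq → distinct (trans (+-suc k i) eq)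
    ; hit      = hit
    ; first    = λ j j<i ne → first (suc j) (s≤s j<i) (λ eq → ne (trans (sym (+-suc k j)) eq)) }
    where open FirstHit h

  FirstHit-cons : ∀ {l p s l' r k i} → ((l' ≡ᵇ l) ∧ not (k ≡ᵇ p)) ≡ false →
                  FirstHit l p r (suc k) i → FirstHit l p ((s , l') ∷ r) k (suc i)
  FirstHit-cons {k = k} {i} test h = record
    { bound    = s≤s bound
    ; distinct = λ eq → distinct (trans (sym (+-suc k i)) eq)
    ; hit      = hit
    ; first    = λ { zero _ ne → miss test (λ eq → ne (trans (+-identityʳ k) eq))
                   ; (suc j) (s≤s j<i) ne → first j j<i (λ eq → ne (trans (+-suc k j) eq)) } }
    where open FirstHit h

search-hit : ∀ {l p r k i} → FirstHit l p r k i → search l p r k ≡ k + i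
search-hit {l} {p} {(s , l') ∷ r} {k} {zero} h
  rewrite ≡⇒≡ᵇ≡true (FirstHit.hit h)
        | ≢⇒≡ᵇ≡false (λ eq → FirstHit.distinct h (trans (+-identityʳ k) eq)) = sym (+-identityʳ k)
search-hit {l} {p} {(s , l') ∷ r} {k} {suc i} h with (l' ≡ᵇ l) ∧ not (k ≡ᵇ p) in test
... | true  = ⊥-elim (first-hit-earlier test)
  where
  first-hit-earlier : ((l' ≡ᵇ l) ∧ not (k ≡ᵇ p)) ≡ true → ⊥
  first-hit-earlier _ with l' ≡ᵇ l in e₁ | k ≡ᵇ p in e₂
  first-hit-earlier () | false | _
  first-hit-earlier () | true  | true
  ... | true | false = FirstHit.first h 0 z<s (λ eq → ≡ᵇ≡false⇒≢ e₂ (trans (sym (+-identityʳ k)) eq))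
                                           (≡ᵇ≡true⇒≡ e₁)
... | false = trans (search-hit (FirstHit-tail h)) (sym (+-suc k i))

search-found : ∀ l p r k → search l p r k ≢ p → Σ ℕ λ i → FirstHit l p r k i × search l p r k ≡ k + i
search-found l p []             k ne = ⊥-elim (ne refl)
search-found l p ((s , l') ∷ r) k ne with (l' ≡ᵇ l) ∧ not (k ≡ᵇ p) in test
... | true  = 0 , hit-at-head , sym (+-identityʳ k)
  where
  hit-at-head : FirstHit l p ((s , l') ∷ r) k 0
  hit-at-head = record
    { bound    = z<s
    ; distinct = λ eq → ne (trans (sym (+-identityʳ k)) eq)
    ; hit      = ≡ᵇ≡true⇒≡ (∧-true-left test)
    ; first    = λ _ () }
    where
    ∧-true-left : ∀ {a b} → a ∧ b ≡ true → a ≡ true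
    ∧-true-left {true} _ = refl
... | false with search-found l p r (suc k) ne
...   | i , h , eq = suc i , FirstHit-cons test h , trans eq (sym (+-suc k i))

-- `partner` searches with a function local to its where-block; unification names it
-- `localSearch` (the with-abstraction puts the equation into the pattern fragment).
private
  mutual
    localSearch : Rotation → ℕ → Rotation → ℕ → ℕ
    localSearch = _

    partner-unfold : ∀ e r p → partner (e ∷ r) p ≡
      (if (proj₂ e ≡ᵇ labelAt (e ∷ r) p) ∧ not (0 ≡ᵇ p) then 0 else localSearch (e ∷ r) p r 1)
    partner-unfold e r p with e ∷ r | 1
    ... | _ | _ = refl

  localSearch≡search : ∀ ρ p r k → localSearch ρ p r k ≡ search (labelAt ρ p) p r k
  localSearch≡search ρ p []            k = refl
  localSearch≡search ρ p ((_ , _) ∷ r) k rewrite localSearch≡search ρ p r (suc k) = refl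

partner≡search : ∀ ρ p → partner ρ p ≡ search (labelAt ρ p) p ρ 0
partner≡search []      p = refl
partner≡search (e ∷ r) p = trans (partner-unfold e r p)
  (cong (if (proj₂ e ≡ᵇ labelAt (e ∷ r) p) ∧ not (0 ≡ᵇ p) then 0 else_) (localSearch≡search (e ∷ r) p r 1))

IsMate : Rotation → ℕ → ℕ → Set
IsMate ρ p q = FirstHit (labelAt ρ p) p ρ 0 q

partner-≡ : ∀ {ρ p q} → IsMate ρ p q → partner ρ p ≡ q
partner-≡ {ρ} {p} h = trans (partner≡search ρ p) (search-hit h)

partner-isMate : ∀ ρ p → partner ρ p ≢ p → IsMate ρ p (partner ρ p)
partner-isMate ρ p ne with search-found (labelAt ρ p) p ρ 0 (λ eq → ne (trans (partner≡search ρ p) eq))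
... | i , h , eq = subst (IsMate ρ p) (sym (trans (partner≡search ρ p) eq)) h

allB-elim : ∀ (P : ℕ → Bool) f n → allB P (applyUpTo f n) ≡ true → ∀ k → k < n → P (f k) ≡ true
allB-elim P f (suc n) h zero    _         with P (f 0)
... | true = refl
allB-elim P f (suc n) h (suc k) (s≤s k<n) with P (f 0)
... | true = allB-elim P (f ∘ suc) n h k k<n

allB-intro : ∀ (P : ℕ → Bool) f n → (∀ k → k < n → P (f k) ≡ true) → allB P (applyUpTo f n) ≡ true
allB-intro P f zero    h = refl
allB-intro P f (suc n) h rewrite h 0 z<s = allB-intro P (f ∘ suc) n (λ k k<n → h (suc k) (s≤s k<n))

count-∷ : ∀ {A : Set} (P : A → Bool) x xs →
          count P (x ∷ xs) ≡ (if P x then suc (count P xs) else count P xs)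
count-∷ P x xs with P x
... | true  = refl
... | false = refl

count-++ : ∀ {A : Set} (P : A → Bool) xs ys → count P (xs ++ ys) ≡ count P xs + count P ys
count-++ P xs ys = trans (cong length (filter-++ _ xs ys)) (length-++ (filter _ xs))

count-applyUpTo-+ : ∀ {A : Set} (P : A → Bool) (f : ℕ → A) m n →
  count P (applyUpTo f (m + n)) ≡ count P (applyUpTo f m) + count P (applyUpTo (λ k → f (m + k)) n)
count-applyUpTo-+ P f zero    n = refl
count-applyUpTo-+ P f (suc m) n
  rewrite count-∷ P (f 0) (applyUpTo (f ∘ suc) (m + n)) | count-∷ P (f 0) (applyUpTo (f ∘ suc) m)
        | count-applyUpTo-+ P (f ∘ suc) m n with P (f 0)
... | true  = refl
... | false = refl

count-applyUpTo-cong : ∀ {A B : Set} (P : A → Bool) (Q : B → Bool) f g n →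
  (∀ k → k < n → P (f k) ≡ Q (g k)) → count P (applyUpTo f n) ≡ count Q (applyUpTo g n)
count-applyUpTo-cong P Q f g zero    h = refl
count-applyUpTo-cong P Q f g (suc n) h
  rewrite count-∷ P (f 0) (applyUpTo (f ∘ suc) n) | count-∷ Q (g 0) (applyUpTo (g ∘ suc) n)
        | h 0 z<s | count-applyUpTo-cong P Q (f ∘ suc) (g ∘ suc) n (λ k k<n → h (suc k) (s≤s k<n))
  = refl

count-applyUpTo-none : ∀ {A : Set} (P : A → Bool) f n → (∀ k → k < n → P (f k) ≡ false) →
                       count P (applyUpTo f n) ≡ 0
count-applyUpTo-none P f zero    h = refl
count-applyUpTo-none P f (suc n) h rewrite count-∷ P (f 0) (applyUpTo (f ∘ suc) n) | h 0 z<s =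
  count-applyUpTo-none P (f ∘ suc) n (λ k k<n → h (suc k) (s≤s k<n))

-- Orbits of two perfect matchings

record IsMatching (N : ℕ) (f : ℕ → ℕ) : Set where
  field
    closed       : ∀ x → x < N → f x < N
    involutive   : ∀ x → x < N → f (f x) ≡ x
    fixpointFree : ∀ x → x < N → f x ≢ x

record Matchings (N : ℕ) (α ε : ℕ → ℕ) : Set where
  field
    arcs  : IsMatching N α
    sides : IsMatching N ε

even : ℕ → Bool
even k = k % 2 ≡ᵇ 0

even-suc : ∀ k → even (suc k) ≡ not (even k)
even-suc zero          = refl
even-suc (suc zero)    = refl
even-suc (suc (suc k)) = even-suc k

even-+2* : ∀ k d → even (k + 2 * d) ≡ even k
even-+2* k d = cong (_≡ᵇ 0) (trans (cong (λ j → (k + j) % 2) (*-comm 2 d)) ([m+kn]%n≡m%n k d 2))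

step : (α ε : ℕ → ℕ) → ℕ → ℕ → ℕ
step α ε k y = if even k then α y else ε y

alternating : (α ε : ℕ → ℕ) → ℕ → ℕ → ℕ
alternating α ε x zero    = x
alternating α ε x (suc k) = step α ε k (alternating α ε x k)

data Reach (α ε : ℕ → ℕ) (x : ℕ) : ℕ → Set where
  here   : Reach α ε x x
  α-step : ∀ {y} → Reach α ε x y → Reach α ε x (α y)
  ε-step : ∀ {y} → Reach α ε x y → Reach α ε x (ε y)

infixl 5 _▸α_ _▸ε_

_▸α_ : ∀ {α ε x y z} → Reach α ε x y → α y ≡ z → Reach α ε x z
r ▸α refl = α-step r

_▸ε_ : ∀ {α ε x y z} → Reach α ε x y → ε y ≡ z → Reach α ε x z
r ▸ε refl = ε-step r

reach-≡ : ∀ {α ε x y} → x ≡ y → Reach α ε x y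
reach-≡ refl = here

reach-trans : ∀ {α ε x y z} → Reach α ε x y → Reach α ε y z → Reach α ε x z
reach-trans r here       = r
reach-trans r (α-step s) = α-step (reach-trans r s)
reach-trans r (ε-step s) = ε-step (reach-trans r s)

reach-alternating : ∀ α ε x k → Reach α ε x (alternating α ε x k)
reach-alternating α ε x zero    = here
reach-alternating α ε x (suc k) with even k
... | true  = α-step (reach-alternating α ε x k)
... | false = ε-step (reach-alternating α ε x k)

IsOrbitMin : (α ε : ℕ → ℕ) → ℕ → Set
IsOrbitMin α ε x = ∀ y → Reach α ε x y → x ≤ y

orbitMinB : (N : ℕ) (α ε : ℕ → ℕ) → ℕ → Bool
orbitMinB N α ε x = allB (λ k → x ≤ᵇ alternating α ε x k) (upTo N)

module Orbits {N : ℕ} {α ε : ℕ → ℕ} (M : Matchings N α ε) where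
  open Matchings M
  module A = IsMatching arcs
  module E = IsMatching sides

  step-matching : ∀ k → IsMatching N (step α ε k)
  step-matching k with even k
  ... | true  = arcs
  ... | false = sides

  module S k = IsMatching (step-matching k)

  step-+2* : ∀ k d y → step α ε (k + 2 * d) y ≡ step α ε k y
  step-+2* k d y rewrite even-+2* k d = refl

  reach-closed : ∀ {x y} → x < N → Reach α ε x y → y < N
  reach-closed x<N here       = x<N
  reach-closed x<N (α-step r) = A.closed _ (reach-closed x<N r)
  reach-closed x<N (ε-step r) = E.closed _ (reach-closed x<N r)

  reach-sym : ∀ {x y} → x < N → Reach α ε x y → Reach α ε y x
  reach-sym x<N here               = here
  reach-sym x<N (α-step {y} r) =
    reach-trans (here ▸α A.involutive y (reach-closed x<N r)) (reach-sym x<N r)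
  reach-sym x<N (ε-step {y} r) =
    reach-trans (here ▸ε E.involutive y (reach-closed x<N r)) (reach-sym x<N r)

  module Walk (x : ℕ) (x<N : x < N) where

    w : ℕ → ℕ
    w = alternating α ε x

    w-closed : ∀ k → w k < N
    w-closed k = reach-closed x<N (reach-alternating α ε x k)

    w-back : ∀ k → step α ε k (w (suc k)) ≡ w k
    w-back k = S.involutive k (w k) (w-closed k)

    -- Steps i and i + 2d + 1 are of different kinds, so an odd return would create a fixed point.
    no-odd-return : ∀ d i → w i ≢ w (suc (i + 2 * d))
    no-odd-return zero    i eq =
      S.fixpointFree i (w i) (w-closed i) (sym (trans eq (cong (w ∘ suc) (+-identityʳ i))))
    no-odd-return (suc d) i eq = no-odd-return d (suc i) (begin
      step α ε i (w i)                              ≡⟨ cong (step α ε i) (trans eq (cong (w ∘ suc) i+2d+2≡)) ⟩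
      step α ε i (step α ε (i + 2 * d) (w (2 + (i + 2 * d)))) ≡⟨ cong (step α ε i) (step-+2* i d (w (2 + (i + 2 * d)))) ⟩
      step α ε i (step α ε i (w (2 + (i + 2 * d)))) ≡⟨ S.involutive i _ (w-closed (2 + (i + 2 * d))) ⟩
      w (2 + (i + 2 * d))                           ∎)
      where
      open ≡-Reasoning
      i+2d+2≡ : i + 2 * suc d ≡ suc (suc (i + 2 * d))
      i+2d+2≡ = trans (cong (i +_) (*-suc 2 d)) (trans (+-suc i _) (cong suc (+-suc i _)))

    even-return : ∀ i d → w i ≡ w (i + 2 * d) → w (2 * d) ≡ x
    even-return zero    d eq = sym eq
    even-return (suc i) d eq = even-return i d (begin
      w i                                              ≡⟨ sym (w-back i) ⟩
      step α ε i (w (suc i))                           ≡⟨ cong (step α ε i) eq ⟩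
      step α ε i (step α ε (i + 2 * d) (w (i + 2 * d))) ≡⟨ cong (step α ε i) (step-+2* i d (w (i + 2 * d))) ⟩
      step α ε i (step α ε i (w (i + 2 * d)))          ≡⟨ S.involutive i _ (w-closed (i + 2 * d)) ⟩
      w (i + 2 * d)                                    ∎)
      where open ≡-Reasoning

    record Period : Set where
      field
        half   : ℕ
        ≤N     : 2 * suc half ≤ N
        closes : w (2 * suc half) ≡ x

    -- Among w 0, ..., w N two coincide; their distance is even and gives the period.
    period : Period
    period with Fin.pigeonhole (n<1+n N) (λ i → fromℕ< (w-closed (toℕ i)))
    ... | i , j , i<j , same = from-gap (toℕ j ∸ toℕ i) (corner (toℕ j ∸ toℕ i)) refl
      where
      a = toℕ i
      b = toℕ j
      wa≡wb : w a ≡ w b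
      wa≡wb = trans (sym (Fin.toℕ-fromℕ< (w-closed a))) (trans (cong toℕ same) (Fin.toℕ-fromℕ< (w-closed b)))
      a+gap≡b : a + (b ∸ a) ≡ b
      a+gap≡b = m+[n∸m]≡n (<⇒≤ i<j)
      from-gap : ∀ g → Corner g → b ∸ a ≡ g → Period
      from-gap .(2 * zero) (left zero) eq =
        ⊥-elim (<⇒≢ i<j (sym (trans (sym a+gap≡b) (trans (cong (a +_) eq) (+-identityʳ a)))))
      from-gap .(2 * suc d) (left (suc d)) eq = record
        { half   = d
        ; ≤N     = ≤-trans (subst (_≤ b) eq (m∸n≤m b a)) (s≤s⁻¹ (Fin.toℕ<n j))
        ; closes = even-return a (suc d) (trans wa≡wb (cong w (trans (sym a+gap≡b) (cong (a +_) eq)))) }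
      from-gap .(2 * d + 1) (right d) eq = ⊥-elim (no-odd-return d a (trans wa≡wb (cong w (begin
        b                ≡⟨ sym a+gap≡b ⟩
        a + (b ∸ a)      ≡⟨ cong (a +_) (trans eq (+-comm (2 * d) 1)) ⟩
        a + suc (2 * d)  ≡⟨ +-suc a (2 * d) ⟩
        suc (a + 2 * d)  ∎))))
        where open ≡-Reasoning

    open Period period

    c : ℕ
    c = 2 * suc half

    periodic : ∀ k → w (k + c) ≡ w k
    periodic zero    = closes
    periodic (suc k) = trans (step-+2* k (suc half) (w (k + c))) (cong (step α ε k) (periodic k))

    periodic-* : ∀ q k → w (k + q * c) ≡ w k
    periodic-* zero    k = cong w (+-identityʳ k)
    periodic-* (suc q) k = trans (cong w (trans (cong (k +_) (+-comm c (q * c))) (sym (+-assoc k (q * c) c))))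
                                 (trans (periodic (k + q * c)) (periodic-* q k))

    within-N : ∀ k → Σ ℕ λ k' → k' < N × w k' ≡ w k
    within-N k = k % c , ≤-trans (m%n<n k c) ≤N ,
      trans (sym (periodic-* (k / c) (k % c))) (cong w (sym (m≡m%n+[m/n]*n k c)))

    private
      step-even : ∀ k → even k ≡ true → ∀ y → step α ε k y ≡ α y
      step-even k e y rewrite e = refl

      step-odd : ∀ k → even k ≡ false → ∀ y → step α ε k y ≡ ε y
      step-odd k e y rewrite e = refl

      odd-suc⇒even : ∀ k → even (suc k) ≡ false → even k ≡ true
      odd-suc⇒even k e with even k | even-suc k
      ... | true | _ = refl
      ... | false | e' with () ← trans (sym e') e

      α-on-walk : ∀ k → Σ ℕ λ k' → w k' ≡ α (w k)
      α-on-walk k with even k in e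
      ... | true = suc k , step-even k e (w k)
      α-on-walk (suc k) | false = k , trans (sym (A.involutive _ (w-closed k)))
                                            (cong α (sym (step-even k (odd-suc⇒even k e) (w k))))

      ε-on-walk : ∀ k → Σ ℕ λ k' → w k' ≡ ε (w k)
      ε-on-walk k with even k in e
      ... | false = suc k , step-odd k e (w k)
      ... | true  = j , (begin
        w j                         ≡⟨ sym (E.involutive _ (w-closed j)) ⟩
        ε (ε (w j))                 ≡⟨ cong ε (sym (step-odd j j-odd (w j))) ⟩
        ε (w (suc j))               ≡⟨ cong (ε ∘ w) (sym k+c≡) ⟩
        ε (w (k + c))               ≡⟨ cong ε (periodic k) ⟩
        ε (w k)                     ∎)
        where
        open ≡-Reasoning
        j = suc (k + 2 * half)
        k+c≡ : k + c ≡ suc j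
        k+c≡ = trans (cong (k +_) (*-suc 2 half)) (trans (+-suc k _) (cong suc (+-suc k _)))
        j-odd : even j ≡ false
        j-odd = trans (even-suc (k + 2 * half)) (cong not (trans (even-+2* k half) e))

    on-walk : ∀ {y} → Reach α ε x y → Σ ℕ λ k → w k ≡ y
    on-walk here = 0 , refl
    on-walk (α-step r) with on-walk r
    ... | k , refl = α-on-walk k
    on-walk (ε-step r) with on-walk r
    ... | k , refl = ε-on-walk k

    on-walk-within-N : ∀ {y} → Reach α ε x y → Σ ℕ λ k → k < N × w k ≡ y
    on-walk-within-N r with on-walk r
    ... | k , refl = within-N k

  orbitMinB-sound : ∀ x → x < N → orbitMinB N α ε x ≡ true → IsOrbitMin α ε x
  orbitMinB-sound x x<N h y r with Walk.on-walk-within-N x x<N r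
  ... | k , k<N , refl = ≤ᵇ⇒≤ x _ (≡true⇒T (allB-elim (λ k → x ≤ᵇ alternating α ε x k) (λ z → z) N h k k<N))

  orbitMinB-complete : ∀ x → IsOrbitMin α ε x → orbitMinB N α ε x ≡ true
  orbitMinB-complete x h = allB-intro (λ k → x ≤ᵇ alternating α ε x k) (λ z → z) N
    (λ k _ → T⇒≡true (≤⇒≤ᵇ (h _ (reach-alternating α ε x k))))

arcStep-matching : ∀ m → IsMatching (2 * suc m) (arcStep m)
arcStep-matching m = record { closed = closed ; involutive = involutive ; fixpointFree = fixpointFree }
  where
  last-or-< : ∀ {p} → 2 * p + 1 < 2 * suc m → p < m ⊎ p ≡ m
  last-or-< x< = m≤n⇒m<n∨m≡n (s≤s⁻¹ (right-<⁻ (suc m) x<))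

  closed : ∀ x → x < 2 * suc m → arcStep m x < 2 * suc m
  closed x x< with corner x
  ... | left zero    rewrite arcStep-first m = right-< (n<1+n m)
  ... | left (suc p) rewrite arcStep-left-suc m p (<-trans (n<1+n p) (left-<⁻ (suc m) x<)) =
    right-< (<-trans (n<1+n p) (left-<⁻ (suc m) x<))
  ... | right p with last-or-< {p} x<
  ...   | inj₂ refl rewrite arcStep-last m = left-< z<s
  ...   | inj₁ p<m rewrite arcStep-right-< m p p<m = left-< (s≤s p<m)

  involutive : ∀ x → x < 2 * suc m → arcStep m (arcStep m x) ≡ x
  involutive x x< with corner x
  ... | left zero    rewrite arcStep-first m = arcStep-last m
  ... | left (suc p) rewrite arcStep-left-suc m p (<-trans (n<1+n p) (left-<⁻ (suc m) x<)) =
    arcStep-right-< m p (s≤s⁻¹ (left-<⁻ (suc m) x<))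
  ... | right p with last-or-< {p} x<
  ...   | inj₂ refl rewrite arcStep-last m = arcStep-first m
  ...   | inj₁ p<m rewrite arcStep-right-< m p p<m = arcStep-left-suc m p (<-trans p<m (n<1+n m))

  fixpointFree : ∀ x → x < 2 * suc m → arcStep m x ≢ x
  fixpointFree x x< with corner x
  ... | left zero    rewrite arcStep-first m = λ eq → left≢right 0 m (sym eq)
  ... | left (suc p) rewrite arcStep-left-suc m p (<-trans (n<1+n p) (left-<⁻ (suc m) x<)) =
    λ eq → left≢right (suc p) p (sym eq)
  ... | right p with last-or-< {p} x<
  ...   | inj₂ refl rewrite arcStep-last m = λ eq → left≢right 0 m eq
  ...   | inj₁ p<m rewrite arcStep-right-< m p p<m = λ eq → left≢right (suc p) p eq

IsPairing : Rotation → Set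
IsPairing ρ = IsMatching (length ρ) (partner ρ)

sameSign-comm : ∀ a b → sameSign a b ≡ sameSign b a
sameSign-comm true  true  = refl
sameSign-comm true  false = refl
sameSign-comm false true  = refl
sameSign-comm false false = refl

module _ (ρ : Rotation) (pairing : IsPairing ρ) where
  open IsMatching pairing

  untwisted-partner : ∀ p → p < length ρ → untwisted ρ (partner ρ p) ≡ untwisted ρ p
  untwisted-partner p p< rewrite involutive p p< = sameSign-comm _ _

  edgeStep-matching : IsMatching (2 * length ρ) (edgeStep ρ)
  edgeStep-matching = record { closed = closedE ; involutive = involutiveE ; fixpointFree = fixpointFreeE }
    where
    closedE : ∀ x → x < 2 * length ρ → edgeStep ρ x < 2 * length ρ
    closedE x x< with corner x
    ... | left p rewrite edgeStep-left ρ p with untwisted ρ p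
    ...   | true  = right-< (closed p (left-<⁻ (length ρ) x<))
    ...   | false = left-< (closed p (left-<⁻ (length ρ) x<))
    closedE x x< | right p rewrite edgeStep-right ρ p with untwisted ρ p
    ...   | true  = left-< (closed p (right-<⁻ (length ρ) x<))
    ...   | false = right-< (closed p (right-<⁻ (length ρ) x<))

    involutiveE : ∀ x → x < 2 * length ρ → edgeStep ρ (edgeStep ρ x) ≡ x
    involutiveE x x< with corner x
    ... | left p rewrite edgeStep-left ρ p with untwisted ρ p in u
    ...   | true  rewrite edgeStep-right ρ (partner ρ p) | untwisted-partner p (left-<⁻ (length ρ) x<) | u
                        | involutive p (left-<⁻ (length ρ) x<) = refl
    ...   | false rewrite edgeStep-left ρ (partner ρ p) | untwisted-partner p (left-<⁻ (length ρ) x<) | u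
                        | involutive p (left-<⁻ (length ρ) x<) = refl
    involutiveE x x< | right p rewrite edgeStep-right ρ p with untwisted ρ p in u
    ...   | true  rewrite edgeStep-left ρ (partner ρ p) | untwisted-partner p (right-<⁻ (length ρ) x<) | u
                        | involutive p (right-<⁻ (length ρ) x<) = refl
    ...   | false rewrite edgeStep-right ρ (partner ρ p) | untwisted-partner p (right-<⁻ (length ρ) x<) | u
                        | involutive p (right-<⁻ (length ρ) x<) = refl

    fixpointFreeE : ∀ x → x < 2 * length ρ → edgeStep ρ x ≢ x
    fixpointFreeE x x< with corner x
    ... | left p rewrite edgeStep-left ρ p with untwisted ρ p
    ...   | true  = λ eq → left≢right p (partner ρ p) (sym eq)
    ...   | false = λ eq → fixpointFree p (left-<⁻ (length ρ) x<) (left-injective eq)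
    fixpointFreeE x x< | right p rewrite edgeStep-right ρ p with untwisted ρ p
    ...   | true  = λ eq → left≢right (partner ρ p) p eq
    ...   | false = λ eq → fixpointFree p (right-<⁻ (length ρ) x<) (right-injective eq)

rotation-matchings : ∀ e ρ → IsPairing (e ∷ ρ) →
  Matchings (2 * suc (length ρ)) (arcStep (length ρ)) (edgeStep (e ∷ ρ))
rotation-matchings e ρ pairing = record
  { arcs = arcStep-matching (length ρ) ; sides = edgeStep-matching (e ∷ ρ) pairing }

walk≡alternating : ∀ ρ m x k → walk ρ m x k ≡ alternating (arcStep m) (edgeStep ρ) x k
walk≡alternating ρ m x zero    = refl
walk≡alternating ρ m x (suc k) rewrite walk≡alternating ρ m x k = refl

boundaryComponents≡orbits : ∀ e ρ → boundaryComponents (e ∷ ρ) ≡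
  count (orbitMinB (2 * suc (length ρ)) (arcStep (length ρ)) (edgeStep (e ∷ ρ))) (upTo (2 * suc (length ρ)))
boundaryComponents≡orbits e ρ = count-applyUpTo-cong _ _ (λ z → z) (λ z → z) (2 * suc (length ρ))
  (λ x _ → allB-cong (upTo (2 * suc (length ρ))) (λ k → cong (x ≤ᵇ_) (walk≡alternating (e ∷ ρ) (length ρ) x k)))
  where
  allB-cong : ∀ {A : Set} {P Q : A → Bool} xs → (∀ a → P a ≡ Q a) → allB P xs ≡ allB Q xs
  allB-cong []       h = refl
  allB-cong (x ∷ xs) h = cong₂ _∧_ (h x) (allB-cong xs h)

-- Surgery

-- The new matchings arise from the old ones by subdividing old steps into paths and adding detached
-- components; every other new corner u leads back to the old corner retract u, embedded below u.

record Surgery (N : ℕ) (α ε : ℕ → ℕ) (N' : ℕ) (α' ε' : ℕ → ℕ) : Set where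
  field
    embed          : ℕ → ℕ
    embed-closed   : ∀ x → x < N → embed x < N'
    embed-mono     : ∀ x y → x < N → y < N → x < y → embed x < embed y
    embed-α        : ∀ x → x < N → Reach α' ε' (embed x) (embed (α x))
    embed-ε        : ∀ x → x < N → Reach α' ε' (embed x) (embed (ε x))
    detached       : ℕ → Bool
    detached-embed : ∀ x → x < N → detached (embed x) ≡ false
    detached-α     : ∀ u → u < N' → detached u ≡ true → detached (α' u) ≡ true
    detached-ε     : ∀ u → u < N' → detached u ≡ true → detached (ε' u) ≡ true
    retract        : ℕ → ℕ
    retract-closed : ∀ u → u < N' → detached u ≡ false → retract u < N
    retract-α      : ∀ u → u < N' → detached u ≡ false → Reach α ε (retract u) (retract (α' u))
    retract-ε      : ∀ u → u < N' → detached u ≡ false → Reach α ε (retract u) (retract (ε' u))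
    retract-embed  : ∀ x → x < N → retract (embed x) ≡ x
    to-embedded    : ∀ u → u < N' → detached u ≡ false → Reach α' ε' u (embed (retract u))
    embedded-≤     : ∀ u → u < N' → detached u ≡ false → embed (retract u) ≤ u

module SurgeryTheorem {N N' : ℕ} {α ε α' ε' : ℕ → ℕ} (M : Matchings N α ε) (M' : Matchings N' α' ε')
                      (σ : Surgery N α ε N' α' ε') where
  open Surgery σ
  module O  = Orbits M
  module O' = Orbits M'
  module A' = IsMatching (Matchings.arcs M')
  module E' = IsMatching (Matchings.sides M')

  private
    attached-α : ∀ u → u < N' → detached u ≡ false → detached (α' u) ≡ false
    attached-α u u< du with detached (α' u) in e
    ... | false = refl
    ... | true with () ← trans (sym (subst (λ v → detached v ≡ true) (A'.involutive u u<)
                                      (detached-α (α' u) (A'.closed u u<) e))) du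

    attached-ε : ∀ u → u < N' → detached u ≡ false → detached (ε' u) ≡ false
    attached-ε u u< du with detached (ε' u) in e
    ... | false = refl
    ... | true with () ← trans (sym (subst (λ v → detached v ≡ true) (E'.involutive u u<)
                                      (detached-ε (ε' u) (E'.closed u u<) e))) du

    attached-reach : ∀ {u v} → u < N' → detached u ≡ false → Reach α' ε' u v → detached v ≡ false
    attached-reach u< du here       = du
    attached-reach u< du (α-step r) = attached-α _ (O'.reach-closed u< r) (attached-reach u< du r)
    attached-reach u< du (ε-step r) = attached-ε _ (O'.reach-closed u< r) (attached-reach u< du r)

    embed-reach : ∀ {x y} → x < N → Reach α ε x y → Reach α' ε' (embed x) (embed y)
    embed-reach x< here       = here
    embed-reach x< (α-step r) = reach-trans (embed-reach x< r) (embed-α _ (O.reach-closed x< r))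
    embed-reach x< (ε-step r) = reach-trans (embed-reach x< r) (embed-ε _ (O.reach-closed x< r))

    retract-reach : ∀ {u v} → u < N' → detached u ≡ false → Reach α' ε' u v → Reach α ε (retract u) (retract v)
    retract-reach u< du here       = here
    retract-reach u< du (α-step r) =
      reach-trans (retract-reach u< du r) (retract-α _ (O'.reach-closed u< r) (attached-reach u< du r))
    retract-reach u< du (ε-step r) =
      reach-trans (retract-reach u< du r) (retract-ε _ (O'.reach-closed u< r) (attached-reach u< du r))

    embed-reflects-≤ : ∀ x y → x < N → y < N → embed x ≤ embed y → x ≤ y
    embed-reflects-≤ x y x< y< h with <-cmp x y
    ... | tri< lt _ _ = <⇒≤ lt
    ... | tri≈ _ refl _ = ≤-refl
    ... | tri> _ _ gt = ⊥-elim (<⇒≱ (embed-mono y x y< x< gt) h)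

    embed-mono-≤ : ∀ x y → x < N → y < N → x ≤ y → embed x ≤ embed y
    embed-mono-≤ x y x< y< x≤y with m≤n⇒m<n∨m≡n x≤y
    ... | inj₁ lt   = <⇒≤ (embed-mono x y x< y< lt)
    ... | inj₂ refl = ≤-refl

    orbitMin-embed⇒ : ∀ x → x < N → IsOrbitMin α' ε' (embed x) → IsOrbitMin α ε x
    orbitMin-embed⇒ x x< h y r = embed-reflects-≤ x y x< (O.reach-closed x< r) (h (embed y) (embed-reach x< r))

    -- Every new point v in the orbit of embed x lies above embed (retract v), an image of the orbit of x.
    orbitMin-embed⇐ : ∀ x → x < N → IsOrbitMin α ε x → IsOrbitMin α' ε' (embed x)
    orbitMin-embed⇐ x x< h v r = ≤-trans (embed-mono-≤ x (retract v) x< (retract-closed v v< dv) (h _ r'))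
                                         (embedded-≤ v v< dv)
      where
      v<  = O'.reach-closed (embed-closed x x<) r
      dv  = attached-reach (embed-closed x x<) (detached-embed x x<) r
      r' : Reach α ε x (retract v)
      r' = subst (λ z → Reach α ε z (retract v)) (retract-embed x x<)
                 (retract-reach (embed-closed x x<) (detached-embed x x<) r)

  orbitMinB-embed : ∀ x → x < N → orbitMinB N' α' ε' (embed x) ≡ orbitMinB N α ε x
  orbitMinB-embed x x< = ⇔→≡ (mk⇔
    (λ e → O.orbitMinB-complete x (orbitMin-embed⇒ x x< (O'.orbitMinB-sound (embed x) (embed-closed x x<) e)))
    (λ e → O'.orbitMinB-complete (embed x) (orbitMin-embed⇐ x x< (O.orbitMinB-sound x x< e))))

  orbitMinB-above-embedded : ∀ u → u < N' → detached u ≡ false → embed (retract u) < u →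
                             orbitMinB N' α' ε' u ≡ false
  orbitMinB-above-embedded u u< du lt with orbitMinB N' α' ε' u in e
  ... | false = refl
  ... | true  = ⊥-elim (<⇒≱ lt (O'.orbitMinB-sound u u< e _ (to-embedded u u< du)))

-- Embedding a bouquet into one with more edges

record Embedding (ρ ρ' : Rotation) : Set where
  field
    position        : ℕ → ℕ
    position-closed : ∀ r → r < length ρ → position r < length ρ'
    position-mono   : ∀ r s → r < length ρ → s < length ρ → r < s → position r < position s
    position-end    : ∀ r → r < length ρ → nth (true , 0) ρ' (position r) ≡ nth (true , 0) ρ r
    image-or-new    : ∀ r' → r' < length ρ' → (Σ ℕ λ r → r < length ρ × position r ≡ r')
                                             ⊎ (∀ r → r < length ρ → labelAt ρ' r' ≢ labelAt ρ r)

module EmbeddingTheorem {ρ ρ' : Rotation} (E : Embedding ρ ρ') (pairing : IsPairing ρ) where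
  open Embedding E
  open IsMatching pairing

  position-injective : ∀ r s → r < length ρ → s < length ρ → position r ≡ position s → r ≡ s
  position-injective r s r< s< eq with <-cmp r s
  ... | tri< lt _ _ = ⊥-elim (<⇒≢ (position-mono r s r< s< lt) eq)
  ... | tri≈ _ e _  = e
  ... | tri> _ _ gt = ⊥-elim (<⇒≢ (position-mono s r s< r< gt) (sym eq))

  position-reflects-< : ∀ r s → r < length ρ → s < length ρ → position r < position s → r < s
  position-reflects-< r s r< s< lt with <-cmp r s
  ... | tri< r<s _ _   = r<s
  ... | tri≈ _ refl _  = ⊥-elim (<-irrefl refl lt)
  ... | tri> _ _ s<r   = ⊥-elim (<-asym lt (position-mono s r s< r< s<r))

  label-embed : ∀ r → r < length ρ → labelAt ρ' (position r) ≡ labelAt ρ r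
  label-embed r r< = cong proj₂ (position-end r r<)

  sign-embed : ∀ r → r < length ρ → signAt ρ' (position r) ≡ signAt ρ r
  sign-embed r r< = cong proj₁ (position-end r r<)

  -- New positions carry new labels, so the first mate of position p is found among the old ones.
  partner-embed : ∀ p → p < length ρ → partner ρ' (position p) ≡ position (partner ρ p)
  partner-embed p p< = partner-≡ {ρ'} record
    { bound    = position-closed q q<
    ; distinct = λ eq → fixpointFree p p< (position-injective q p q< p< eq)
    ; hit      = trans (label-embed q q<) (trans (FirstHit.hit mate) (sym (label-embed p p<)))
    ; first    = earlier }
    where
    q    = partner ρ p
    q<   = closed p p<
    mate = partner-isMate ρ p (fixpointFree p p<)
    earlier : ∀ j → j < position q → j ≢ position p → labelAt ρ' j ≢ labelAt ρ' (position p)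
    earlier j j< j≢ with image-or-new j (<-trans j< (position-closed q q<))
    ... | inj₁ (r , r< , refl) = λ eq → FirstHit.first mate r (position-reflects-< r q r< q< j<)
                                           (λ r≡p → j≢ (cong position r≡p))
                                           (trans (sym (label-embed r r<)) (trans eq (label-embed p p<)))
    ... | inj₂ new = λ eq → new p p< (trans eq (label-embed p p<))

  untwisted-embed : ∀ p → p < length ρ → untwisted ρ' (position p) ≡ untwisted ρ p
  untwisted-embed p p< rewrite partner-embed p p< =
    cong₂ sameSign (sign-embed p p<) (sign-embed (partner ρ p) (closed p p<))

  edgeStep-embed : (φ : ℕ → ℕ) → (∀ r → r < length ρ → φ (2 * r) ≡ 2 * position r) →
                   (∀ r → r < length ρ → φ (2 * r + 1) ≡ 2 * position r + 1) →
                   ∀ x → x < 2 * length ρ → edgeStep ρ' (φ x) ≡ φ (edgeStep ρ x)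
  edgeStep-embed φ φ-left φ-right x x< with corner x
  ... | left p rewrite φ-left p (left-<⁻ (length ρ) x<) | edgeStep-left ρ' (position p) | edgeStep-left ρ p
                     | untwisted-embed p (left-<⁻ (length ρ) x<) | partner-embed p (left-<⁻ (length ρ) x<)
                with untwisted ρ p
  ...   | true  = sym (φ-right (partner ρ p) (closed p (left-<⁻ (length ρ) x<)))
  ...   | false = sym (φ-left (partner ρ p) (closed p (left-<⁻ (length ρ) x<)))
  edgeStep-embed φ φ-left φ-right x x< | right p
                rewrite φ-right p (right-<⁻ (length ρ) x<) | edgeStep-right ρ' (position p) | edgeStep-right ρ p
                      | untwisted-embed p (right-<⁻ (length ρ) x<) | partner-embed p (right-<⁻ (length ρ) x<)
                with untwisted ρ p
  ...   | true  = sym (φ-left (partner ρ p) (closed p (right-<⁻ (length ρ) x<)))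
  ...   | false = sym (φ-right (partner ρ p) (closed p (right-<⁻ (length ρ) x<)))

  MateLaws : ℕ → Set
  MateLaws p = partner ρ' p < length ρ' × partner ρ' p ≢ p × partner ρ' (partner ρ' p) ≡ p

  mutual-mates : ∀ {p q} → q < length ρ' → q ≢ p → partner ρ' p ≡ q → partner ρ' q ≡ p → MateLaws p
  mutual-mates q< q≢p pq qp = subst (_< length ρ') (sym pq) q< , (λ eq → q≢p (trans (sym pq) eq)) ,
                              trans (cong (partner ρ') pq) qp

  mateLaws-embed : ∀ r → r < length ρ → MateLaws (position r)
  mateLaws-embed r r< = mutual-mates (position-closed _ (closed r r<))
    (λ eq → fixpointFree r r< (position-injective _ r (closed r r<) r< eq))
    (partner-embed r r<) (trans (partner-embed (partner ρ r) (closed r r<)) (cong position (involutive r r<)))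

  isPairing-extend : (∀ p → p < length ρ' → (Σ ℕ λ r → r < length ρ × position r ≡ p) ⊎ MateLaws p) → IsPairing ρ'
  isPairing-extend cases = record
    { closed       = λ p p< → proj₁ (laws p p<)
    ; fixpointFree = λ p p< → proj₁ (proj₂ (laws p p<))
    ; involutive   = λ p p< → proj₂ (proj₂ (laws p p<)) }
    where
    laws : ∀ p → p < length ρ' → MateLaws p
    laws p p< with cases p p<
    ... | inj₁ (r , r< , refl) = mateLaws-embed r r<
    ... | inj₂ l               = l

-- Appending a trivial loop

module AppendLoop (e : End) (X : Rotation) (a : ℕ) (pairing : IsPairing (e ∷ X))
                  (fresh : ∀ r → r < length (e ∷ X) → labelAt (e ∷ X) r ≢ a) where

  ρ ρ' : Rotation
  ρ  = e ∷ X
  ρ' = e ∷ (X ++ pos a ∷ pos a ∷ [])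

  m : ℕ
  m = length X

  length-ρ' : length (X ++ pos a ∷ pos a ∷ []) ≡ suc (suc m)
  length-ρ' = trans (length-++ X) (+-comm m 2)

  position-< : ∀ {p} → p < length ρ' → p < suc m ⊎ p ≡ suc m ⊎ p ≡ suc (suc m)
  position-< {p} p< with m≤n⇒m<n∨m≡n (s≤s⁻¹ (subst (p <_) (cong suc length-ρ') p<))
  ... | inj₂ p≡ = inj₂ (inj₂ p≡)
  ... | inj₁ p< with m≤n⇒m<n∨m≡n (s≤s⁻¹ p<)
  ...   | inj₂ p≡ = inj₂ (inj₁ p≡)
  ...   | inj₁ p< = inj₁ p<

  end-old : ∀ r → r < suc m → nth (true , 0) ρ' r ≡ nth (true , 0) ρ r
  end-old r r< = nth-++ˡ (true , 0) ρ (pos a ∷ pos a ∷ []) r r<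

  end-a₁ : nth (true , 0) ρ' (suc m) ≡ pos a
  end-a₁ = trans (cong (nth (true , 0) ρ') (sym (+-identityʳ (suc m)))) (nth-++ʳ (true , 0) ρ _ 0)

  end-a₂ : nth (true , 0) ρ' (suc (suc m)) ≡ pos a
  end-a₂ = trans (cong (nth (true , 0) ρ') (+-comm 1 (suc m))) (nth-++ʳ (true , 0) ρ _ 1)

  ρ'-length-< : ∀ {p} → p < suc (suc (suc m)) → p < length ρ'
  ρ'-length-< {p} = subst (p <_) (sym (cong suc length-ρ'))

  embedding : Embedding ρ ρ'
  embedding = record
    { position        = λ r → r
    ; position-closed = λ r r< → ρ'-length-< (<-trans r< (<-trans (n<1+n (suc m)) (n<1+n (suc (suc m)))))
    ; position-mono   = λ _ _ _ _ lt → lt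
    ; position-end    = end-old
    ; image-or-new    = image-or-new }
    where
    image-or-new : ∀ r' → r' < length ρ' → (Σ ℕ λ r → r < length ρ × r ≡ r')
                                          ⊎ (∀ r → r < length ρ → labelAt ρ' r' ≢ labelAt ρ r)
    image-or-new r' r'< with position-< r'<
    ... | inj₁ r'<        = inj₁ (r' , r'< , refl)
    ... | inj₂ (inj₁ refl) = inj₂ λ r r< eq → fresh r r< (trans (sym eq) (cong proj₂ end-a₁))
    ... | inj₂ (inj₂ refl) = inj₂ λ r r< eq → fresh r r< (trans (sym eq) (cong proj₂ end-a₂))

  module Emb = EmbeddingTheorem embedding pairing

  private
    old-label-≢ : ∀ j → j < suc m → labelAt ρ' j ≢ a
    old-label-≢ j j< eq = fresh j j< (trans (sym (cong proj₂ (end-old j j<))) eq)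

  partner-a₁ : partner ρ' (suc m) ≡ suc (suc m)
  partner-a₁ = partner-≡ {ρ'} record
    { bound    = ρ'-length-< (n<1+n (suc (suc m)))
    ; distinct = λ eq → 1+n≢n eq
    ; hit      = trans (cong proj₂ end-a₂) (sym (cong proj₂ end-a₁))
    ; first    = λ j j< j≢ eq → old-label-≢ j (≤∧≢⇒< (s≤s⁻¹ j<) j≢) (trans eq (cong proj₂ end-a₁)) }

  partner-a₂ : partner ρ' (suc (suc m)) ≡ suc m
  partner-a₂ = partner-≡ {ρ'} record
    { bound    = ρ'-length-< (<-trans (n<1+n (suc m)) (n<1+n (suc (suc m))))
    ; distinct = λ eq → 1+n≢n (sym eq)
    ; hit      = trans (cong proj₂ end-a₁) (sym (cong proj₂ end-a₂))
    ; first    = λ j j< _ eq → old-label-≢ j j< (trans eq (cong proj₂ end-a₂)) }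

  pairing' : IsPairing ρ'
  pairing' = Emb.isPairing-extend λ p p< → case p p< (position-< p<)
    where
    case : ∀ p → p < length ρ' → p < suc m ⊎ p ≡ suc m ⊎ p ≡ suc (suc m) →
           (Σ ℕ λ r → r < length ρ × r ≡ p) ⊎ Emb.MateLaws p
    case p _ (inj₁ p<)          = inj₁ (p , p< , refl)
    case _ _ (inj₂ (inj₁ refl)) = inj₂ (Emb.mutual-mates (ρ'-length-< (n<1+n (suc (suc m)))) (λ eq → 1+n≢n eq)
                                                         partner-a₁ partner-a₂)
    case _ _ (inj₂ (inj₂ refl)) = inj₂ (Emb.mutual-mates (ρ'-length-< (<-trans (n<1+n (suc m)) (n<1+n (suc (suc m)))))
                                                         (λ eq → 1+n≢n (sym eq)) partner-a₂ partner-a₁)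

  N N' : ℕ
  N  = 2 * suc m
  N' = 2 * suc (suc (suc m))

  α ε α' ε' : ℕ → ℕ
  α  = arcStep m
  ε  = edgeStep ρ
  α' = arcStep (suc (suc m))
  ε' = edgeStep ρ'

  matchings : Matchings N α ε
  matchings = rotation-matchings e X pairing

  matchings' : Matchings N' α' ε'
  matchings' = subst (λ k → Matchings (2 * suc k) (arcStep k) ε') length-ρ' (rotation-matchings e _ pairing')

  last a₁L a₁R a₂L a₂R : ℕ
  last = 2 * m + 1
  a₁L  = 2 * suc m
  a₁R  = 2 * suc m + 1
  a₂L  = 2 * suc (suc m)
  a₂R  = 2 * suc (suc m) + 1

  α'-0 : α' 0 ≡ a₂R
  α'-0 = arcStep-first (suc (suc m))
  α'-a₂R : α' a₂R ≡ 0
  α'-a₂R = arcStep-last (suc (suc m))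
  α'-last : α' last ≡ a₁L
  α'-last = arcStep-right-< (suc (suc m)) m (≤-trans (n<1+n m) (n≤1+n (suc m)))
  α'-a₁L : α' a₁L ≡ last
  α'-a₁L = arcStep-left-suc (suc (suc m)) m (≤-trans (n<1+n m) (≤-trans (n≤1+n (suc m)) (n≤1+n (suc (suc m)))))
  α'-a₁R : α' a₁R ≡ a₂L
  α'-a₁R = arcStep-right-< (suc (suc m)) (suc m) (n<1+n (suc m))
  α'-a₂L : α' a₂L ≡ a₁R
  α'-a₂L = arcStep-left-suc (suc (suc m)) (suc m) (≤-trans (n<1+n (suc m)) (n≤1+n (suc (suc m))))
  α'-interior : ∀ x → x < N → x ≢ 0 → x ≢ last → α' x ≡ α x
  α'-interior x = arcStep-interior m (suc (suc m)) x (≤-trans (n≤1+n m) (n≤1+n (suc m)))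

  α-0 : α 0 ≡ last
  α-0 = arcStep-first m
  α-last : α last ≡ 0
  α-last = arcStep-last m

  ε'-old : ∀ x → x < N → ε' x ≡ ε x
  ε'-old = Emb.edgeStep-embed (λ z → z) (λ _ _ → refl) (λ _ _ → refl)

  untwisted-a₁ : untwisted ρ' (suc m) ≡ true
  untwisted-a₁ = cong₂ sameSign (cong proj₁ end-a₁) (trans (cong (signAt ρ') partner-a₁) (cong proj₁ end-a₂))

  untwisted-a₂ : untwisted ρ' (suc (suc m)) ≡ true
  untwisted-a₂ = cong₂ sameSign (cong proj₁ end-a₂) (trans (cong (signAt ρ') partner-a₂) (cong proj₁ end-a₁))

  ε'-a₁L : ε' a₁L ≡ a₂R
  ε'-a₁L rewrite edgeStep-left ρ' (suc m) | untwisted-a₁ | partner-a₁ = refl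
  ε'-a₁R : ε' a₁R ≡ a₂L
  ε'-a₁R rewrite edgeStep-right ρ' (suc m) | untwisted-a₁ | partner-a₁ = refl
  ε'-a₂L : ε' a₂L ≡ a₁R
  ε'-a₂L rewrite edgeStep-left ρ' (suc (suc m)) | untwisted-a₂ | partner-a₂ = refl
  ε'-a₂R : ε' a₂R ≡ a₁L
  ε'-a₂R rewrite edgeStep-right ρ' (suc (suc m)) | untwisted-a₂ | partner-a₂ = refl

  last<N : last < N
  last<N = right-< (n<1+n m)
  a₁R<a₂L : a₁R < a₂L
  a₁R<a₂L = ≤-reflexive (trans (cong suc (+-comm a₁L 1)) (sym (*-suc 2 (suc m))))

  data NewCorner (u : ℕ) : Set where
    old : u < N → NewCorner u
    is-a₁L : u ≡ a₁L → NewCorner u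
    is-a₁R : u ≡ a₁R → NewCorner u
    is-a₂L : u ≡ a₂L → NewCorner u
    is-a₂R : u ≡ a₂R → NewCorner u

  newCorner : ∀ u → u < N' → NewCorner u
  newCorner u u< with corner u
  ... | left p with position-< {p} (ρ'-length-< (left-<⁻ (suc (suc (suc m))) u<))
  ...   | inj₁ p<          = old (left-< p<)
  ...   | inj₂ (inj₁ refl) = is-a₁L refl
  ...   | inj₂ (inj₂ refl) = is-a₂L refl
  newCorner u u< | right p with position-< {p} (ρ'-length-< (right-<⁻ (suc (suc (suc m))) u<))
  ...   | inj₁ p<          = old (right-< p<)
  ...   | inj₂ (inj₁ refl) = is-a₁R refl
  ...   | inj₂ (inj₂ refl) = is-a₂R refl

  -- The corners a₁R, a₂L form the new boundary component; a₁L, a₂R subdivide the arc from last to 0.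
  detached : ℕ → Bool
  detached u = (u ≡ᵇ a₁R) ∨ (u ≡ᵇ a₂L)

  retract : ℕ → ℕ
  retract u = if u <ᵇ N then u else (if u ≡ᵇ a₁L then last else 0)

  retract-old : ∀ {u} → u < N → retract u ≡ u
  retract-old = if-< _ _
  retract-a₁L : retract a₁L ≡ last
  retract-a₁L rewrite if-≥ {m = a₁L} {N} a₁L (if a₁L ≡ᵇ a₁L then last else 0) ≤-refl
                    | ≡⇒≡ᵇ≡true {a₁L} refl = refl
  retract-a₂R : retract a₂R ≡ 0
  retract-a₂R rewrite if-≥ {m = a₂R} {N} a₂R (if a₂R ≡ᵇ a₁L then last else 0)
                          (≤-trans (left-≤ (n≤1+n (suc m))) (m≤m+n a₂L 1))
                    | ≢⇒≡ᵇ≡false (λ eq → left≢right (suc m) (suc (suc m)) (sym eq)) = refl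

  detached-false : ∀ u → u ≢ a₁R → u ≢ a₂L → detached u ≡ false
  detached-false u ne₁ ne₂ rewrite ≢⇒≡ᵇ≡false ne₁ | ≢⇒≡ᵇ≡false ne₂ = refl
  detached-old : ∀ u → u < N → detached u ≡ false
  detached-old u u< = detached-false u (λ eq → <⇒≱ u< (subst (N ≤_) (sym eq) (m≤m+n N 1)))
                                       (λ eq → <⇒≱ u< (subst (N ≤_) (sym eq) (left-≤ (n≤1+n (suc m)))))
  detached-a₁L : detached a₁L ≡ false
  detached-a₁L = detached-false a₁L (λ eq → left≢right (suc m) (suc m) eq)
                                    (λ eq → 1+n≢n (sym (left-injective {suc m} {suc (suc m)} eq)))
  detached-a₂R : detached a₂R ≡ false
  detached-a₂R = detached-false a₂R (λ eq → 1+n≢n (right-injective {suc (suc m)} {suc m} eq))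
                                    (λ eq → left≢right (suc (suc m)) (suc (suc m)) (sym eq))
  detached-a₁R : detached a₁R ≡ true
  detached-a₁R rewrite ≡⇒≡ᵇ≡true {a₁R} refl = refl
  detached-a₂L : detached a₂L ≡ true
  detached-a₂L rewrite ≡⇒≡ᵇ≡true {a₂L} refl | ≢⇒≡ᵇ≡false (λ eq → left≢right (suc (suc m)) (suc m) eq) = refl

  private
    detached-absurd : ∀ {A : Set} u → detached u ≡ false → detached u ≡ true → A
    detached-absurd _ f t with () ← trans (sym f) t

    0<N : 0 < N
    0<N = z<s

  embed-α : ∀ x → x < N → Reach α' ε' x (α x)
  embed-α x x< with x ≟ 0 | x ≟ last
  ... | yes refl | _        = here ▸α α'-0 ▸ε ε'-a₂R ▸α trans α'-a₁L (sym α-0)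
  ... | no _     | yes refl = here ▸α α'-last ▸ε ε'-a₁L ▸α trans α'-a₂R (sym α-last)
  ... | no x≢0   | no x≢ℓ   = here ▸α α'-interior x x< x≢0 x≢ℓ

  detached-α : ∀ u → u < N' → detached u ≡ true → detached (α' u) ≡ true
  detached-α u u< du with newCorner u u<
  ... | old u<N     = detached-absurd u (detached-old u u<N) du
  ... | is-a₁L refl = detached-absurd a₁L detached-a₁L du
  ... | is-a₂R refl = detached-absurd a₂R detached-a₂R du
  ... | is-a₁R refl = trans (cong detached α'-a₁R) detached-a₂L
  ... | is-a₂L refl = trans (cong detached α'-a₂L) detached-a₁R

  detached-ε : ∀ u → u < N' → detached u ≡ true → detached (ε' u) ≡ true
  detached-ε u u< du with newCorner u u<
  ... | old u<N     = detached-absurd u (detached-old u u<N) du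
  ... | is-a₁L refl = detached-absurd a₁L detached-a₁L du
  ... | is-a₂R refl = detached-absurd a₂R detached-a₂R du
  ... | is-a₁R refl = trans (cong detached ε'-a₁R) detached-a₂L
  ... | is-a₂L refl = trans (cong detached ε'-a₂L) detached-a₁R

  retract-closed : ∀ u → u < N' → detached u ≡ false → retract u < N
  retract-closed u u< du with newCorner u u<
  ... | old u<N     = subst (_< N) (sym (retract-old u<N)) u<N
  ... | is-a₁L refl = subst (_< N) (sym retract-a₁L) last<N
  ... | is-a₂R refl = subst (_< N) (sym retract-a₂R) 0<N
  ... | is-a₁R refl = detached-absurd a₁R du detached-a₁R
  ... | is-a₂L refl = detached-absurd a₂L du detached-a₂L

  retract-α : ∀ u → u < N' → detached u ≡ false → Reach α ε (retract u) (retract (α' u))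
  retract-α u u< du with newCorner u u<
  ... | is-a₁R refl = detached-absurd a₁R du detached-a₁R
  ... | is-a₂L refl = detached-absurd a₂L du detached-a₂L
  ... | is-a₁L refl = reach-≡ (trans retract-a₁L (sym (trans (cong retract α'-a₁L) (retract-old last<N))))
  ... | is-a₂R refl = reach-≡ (trans retract-a₂R (sym (trans (cong retract α'-a₂R) (retract-old 0<N))))
  ... | old u<N with u ≟ 0 | u ≟ last
  ...   | yes refl | _        = reach-≡ (trans (retract-old u<N) (sym (trans (cong retract α'-0) retract-a₂R)))
  ...   | no _     | yes refl = reach-≡ (trans (retract-old u<N) (sym (trans (cong retract α'-last) retract-a₁L)))
  ...   | no u≢0   | no u≢ℓ   = reach-≡ (retract-old u<N)
    ▸α sym (trans (cong retract (α'-interior u u<N u≢0 u≢ℓ)) (retract-old (arcStep-matching m .IsMatching.closed u u<N)))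

  retract-ε : ∀ u → u < N' → detached u ≡ false → Reach α ε (retract u) (retract (ε' u))
  retract-ε u u< du with newCorner u u<
  ... | is-a₁R refl = detached-absurd a₁R du detached-a₁R
  ... | is-a₂L refl = detached-absurd a₂L du detached-a₂L
  ... | old u<N     = reach-≡ (retract-old u<N)
    ▸ε sym (trans (cong retract (ε'-old u u<N)) (retract-old (edgeStep-matching ρ pairing .IsMatching.closed u u<N)))
  ... | is-a₁L refl = reach-≡ retract-a₁L ▸α trans α-last (sym (trans (cong retract ε'-a₁L) retract-a₂R))
  ... | is-a₂R refl = reach-≡ retract-a₂R ▸α trans α-0 (sym (trans (cong retract ε'-a₂R) retract-a₁L))

  to-embedded : ∀ u → u < N' → detached u ≡ false → Reach α' ε' u (retract u)
  to-embedded u u< du with newCorner u u<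
  ... | is-a₁R refl = detached-absurd a₁R du detached-a₁R
  ... | is-a₂L refl = detached-absurd a₂L du detached-a₂L
  ... | old u<N     = reach-≡ (sym (retract-old u<N))
  ... | is-a₁L refl = here ▸α trans α'-a₁L (sym retract-a₁L)
  ... | is-a₂R refl = here ▸α trans α'-a₂R (sym retract-a₂R)

  embedded-≤ : ∀ u → u < N' → detached u ≡ false → retract u ≤ u
  embedded-≤ u u< du with newCorner u u<
  ... | is-a₁R refl = detached-absurd a₁R du detached-a₁R
  ... | is-a₂L refl = detached-absurd a₂L du detached-a₂L
  ... | old u<N     = ≤-reflexive (retract-old u<N)
  ... | is-a₁L refl = subst (_≤ a₁L) (sym retract-a₁L) (<⇒≤ last<N)
  ... | is-a₂R refl = subst (_≤ a₂R) (sym retract-a₂R) z≤n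

  surgery : Surgery N α ε N' α' ε'
  surgery = record
    { embed          = λ x → x
    ; embed-closed   = λ x x< → <-≤-trans x< (left-≤ (≤-trans (n≤1+n (suc m)) (n≤1+n (suc (suc m)))))
    ; embed-mono     = λ _ _ _ _ lt → lt
    ; embed-α        = embed-α
    ; embed-ε        = λ x x< → here ▸ε ε'-old x x<
    ; detached       = detached
    ; detached-embed = detached-old
    ; detached-α     = detached-α
    ; detached-ε     = detached-ε
    ; retract        = retract
    ; retract-closed = retract-closed
    ; retract-α      = retract-α
    ; retract-ε      = retract-ε
    ; retract-embed  = λ x x< → retract-old x<
    ; to-embedded    = to-embedded
    ; embedded-≤     = embedded-≤ }

  module Thm = SurgeryTheorem matchings matchings' surgery
  module O' = Orbits matchings'

  orbitMin' : ℕ → Bool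
  orbitMin' = orbitMinB N' α' ε'

  orbitMin'-a₁R : orbitMin' a₁R ≡ true
  orbitMin'-a₁R = O'.orbitMinB-complete a₁R (λ y r → ≤-a₁R y (reach-detached r))
    where
    a₁R<N' : a₁R < N'
    a₁R<N' = right-< (≤-trans (n<1+n (suc m)) (n≤1+n (suc (suc m))))
    reach-detached : ∀ {y} → Reach α' ε' a₁R y → detached y ≡ true
    reach-detached here       = detached-a₁R
    reach-detached (α-step {y} r) = Surgery.detached-α surgery y (O'.reach-closed a₁R<N' r) (reach-detached r)
    reach-detached (ε-step {y} r) = Surgery.detached-ε surgery y (O'.reach-closed a₁R<N' r) (reach-detached r)
    ≤-a₁R : ∀ y → detached y ≡ true → a₁R ≤ y
    ≤-a₁R y dy with y ≡ᵇ a₁R in e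
    ... | true  = ≤-reflexive (sym (≡ᵇ≡true⇒≡ e))
    ... | false = ≤-trans (<⇒≤ a₁R<a₂L) (≤-reflexive (sym (≡ᵇ≡true⇒≡ dy)))

  orbitMin'-a₂L : orbitMin' a₂L ≡ false
  orbitMin'-a₂L with orbitMin' a₂L in e
  ... | false = refl
  ... | true  = ⊥-elim (<⇒≱ a₁R<a₂L (O'.orbitMinB-sound a₂L (left-< (n<1+n (suc (suc m)))) e a₁R (here ▸α α'-a₂L)))

  orbitMin'-a₁L : orbitMin' a₁L ≡ false
  orbitMin'-a₁L = Thm.orbitMinB-above-embedded a₁L (left-< (≤-trans (n<1+n (suc m)) (n≤1+n (suc (suc m)))))
                    detached-a₁L (subst (_< a₁L) (sym retract-a₁L) last<N)

  orbitMin'-a₂R : orbitMin' a₂R ≡ false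
  orbitMin'-a₂R = Thm.orbitMinB-above-embedded a₂R (right-< (n<1+n (suc (suc m))))
                    detached-a₂R (subst (_< a₂R) (sym retract-a₂R) z<s)

  boundaryComponents-append : boundaryComponents ρ' ≡ suc (boundaryComponents ρ)
  boundaryComponents-append = begin
    boundaryComponents ρ'
      ≡⟨ trans (boundaryComponents≡orbits e (X ++ pos a ∷ pos a ∷ []))
               (cong (λ k → count (orbitMinB (2 * suc k) (arcStep k) ε') (upTo (2 * suc k))) length-ρ') ⟩
    count orbitMin' (upTo N')
      ≡⟨ cong (count orbitMin' ∘ upTo) N'≡N+4 ⟩
    count orbitMin' (upTo (N + 4))
      ≡⟨ count-applyUpTo-+ orbitMin' (λ z → z) N 4 ⟩
    count orbitMin' (upTo N) + count orbitMin' (applyUpTo (N +_) 4)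
      ≡⟨ cong₂ _+_ (count-applyUpTo-cong orbitMin' (orbitMinB N α ε) (λ z → z) (λ z → z) N
                      (λ x x< → Thm.orbitMinB-embed x x<))
                   new-corners ⟩
    count (orbitMinB N α ε) (upTo N) + 1
      ≡⟨ cong (_+ 1) (sym (boundaryComponents≡orbits e X)) ⟩
    boundaryComponents ρ + 1
      ≡⟨ +-comm _ 1 ⟩
    suc (boundaryComponents ρ) ∎
    where
    open ≡-Reasoning
    N'≡N+4 : N' ≡ N + 4
    N'≡N+4 = trans (*-distribˡ-+ 2 2 (suc m)) (+-comm 4 N)
    new-corners : count orbitMin' (applyUpTo (N +_) 4) ≡ 1
    new-corners
      rewrite trans (cong orbitMin' (+-identityʳ N)) orbitMin'-a₁L | orbitMin'-a₁R
            | trans (cong orbitMin' (trans (+-comm N 2) (sym (*-suc 2 (suc m))))) orbitMin'-a₂L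
            | trans (cong orbitMin' (trans (+-comm N 3) (trans (cong suc (sym (*-suc 2 (suc m)))) (+-comm 1 a₂L))))
                    orbitMin'-a₂R = refl

  appendLoop : boundaryComponents ρ' ≡ suc (boundaryComponents ρ) × IsPairing ρ'
  appendLoop = boundaryComponents-append , pairing'

-- Inserting a handle

handleTail : ℕ → ℕ → Rotation
handleTail a b = pos b ∷ pos a ∷ pos b ∷ []

module InsertHandle (e : End) (P Z : Rotation) (a b : ℕ) (a≢b : a ≢ b) (pairing : IsPairing (e ∷ P ++ Z))
                    (fresh-a : ∀ r → r < length (e ∷ P ++ Z) → labelAt (e ∷ P ++ Z) r ≢ a)
                    (fresh-b : ∀ r → r < length (e ∷ P ++ Z) → labelAt (e ∷ P ++ Z) r ≢ b) where

  ρ ρ' : Rotation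
  ρ  = e ∷ P ++ Z
  ρ' = e ∷ P ++ pos a ∷ Z ++ handleTail a b

  q z i₀ m L : ℕ
  q  = length P
  z  = length Z
  i₀ = suc q
  m  = q + z
  L  = suc m

  length-ρ : length ρ ≡ L
  length-ρ = cong suc (length-++ P)

  length-ρ' : length ρ' ≡ suc (suc (suc (suc L)))
  length-ρ' = cong suc (trans (length-++ P) (trans (cong (λ k → q + suc k) (trans (length-++ Z) (+-comm z 3)))
                                                   (+-4 q z)))
    where
    +-4 : ∀ q z → q + (4 + z) ≡ 4 + (q + z)
    +-4 = solve-∀

  d₀ : End
  d₀ = (true , 0)

  end-P : ∀ r → r < i₀ → nth d₀ ρ' r ≡ nth d₀ ρ r
  end-P r r< = trans (nth-++ˡ d₀ (e ∷ P) (pos a ∷ Z ++ handleTail a b) r r<) (sym (nth-++ˡ d₀ (e ∷ P) Z r r<))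

  end-Z : ∀ i → i < z → nth d₀ ρ' (suc (i₀ + i)) ≡ nth d₀ ρ (i₀ + i)
  end-Z i i< = trans (cong (nth d₀ ρ') (sym (+-suc i₀ i)))
    (trans (nth-++ʳ d₀ (e ∷ P) (pos a ∷ Z ++ handleTail a b) (suc i))
           (trans (nth-++ˡ d₀ Z (handleTail a b) i i<) (sym (nth-++ʳ d₀ (e ∷ P) Z i))))

  end-a₁ : nth d₀ ρ' i₀ ≡ pos a
  end-a₁ = trans (cong (nth d₀ ρ') (sym (+-identityʳ i₀))) (nth-++ʳ d₀ (e ∷ P) (pos a ∷ Z ++ handleTail a b) 0)

  end-handle : ∀ k → nth d₀ ρ' (k + suc L) ≡ nth d₀ (handleTail a b) k
  end-handle k = trans (cong (nth d₀ ρ') eq)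
    (trans (nth-++ʳ d₀ (e ∷ P) (pos a ∷ Z ++ handleTail a b) (suc (z + k))) (nth-++ʳ d₀ Z (handleTail a b) k))
    where
    eq : k + suc L ≡ i₀ + suc (z + k)
    eq = trans (+-comm k (suc L)) (trans (cong suc (+-assoc i₀ z k)) (sym (+-suc i₀ (z + k))))

  end-b₁ : nth d₀ ρ' (suc L) ≡ pos b
  end-b₁ = end-handle 0
  end-a₂ : nth d₀ ρ' (suc (suc L)) ≡ pos a
  end-a₂ = end-handle 1
  end-b₂ : nth d₀ ρ' (suc (suc (suc L))) ≡ pos b
  end-b₂ = end-handle 2

  data Position (j : ℕ) : Set where
    in-P  : j < i₀ → Position j
    at-a₁ : j ≡ i₀ → Position j
    in-Z  : ∀ i → i < z → j ≡ suc (i₀ + i) → Position j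
    at-b₁ : j ≡ suc L → Position j
    at-a₂ : j ≡ suc (suc L) → Position j
    at-b₂ : j ≡ suc (suc (suc L)) → Position j

  position : ∀ j → j < suc (suc (suc (suc L))) → Position j
  position j j< with j <? suc L
  ... | no j≮ = in-handle (j ∸ suc L) (sym (trans (+-comm (j ∸ suc L) (suc L)) (m+[n∸m]≡n (≮⇒≥ j≮))))
    where
    in-handle : ∀ k → j ≡ k + suc L → Position j
    in-handle 0 eq = at-b₁ eq
    in-handle 1 eq = at-a₂ eq
    in-handle 2 eq = at-b₂ eq
    in-handle (suc (suc (suc k))) eq =
      ⊥-elim (<⇒≱ j< (subst (_ ≤_) (sym eq) (s≤s (s≤s (s≤s (m≤n+m (suc L) k))))))
  ... | yes j<sL with <-cmp j i₀
  ...   | tri< j<i₀ _ _ = in-P j<i₀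
  ...   | tri≈ _ j≡i₀ _ = at-a₁ j≡i₀
  ...   | tri> _ _ i₀<j = in-Z (j ∸ suc i₀) i<z (sym (m+[n∸m]≡n i₀<j))
    where
    i<z : j ∸ suc i₀ < z
    i<z = +-cancelˡ-< (suc i₀) (j ∸ suc i₀) z (subst (_< suc L) (sym (m+[n∸m]≡n i₀<j)) j<sL)

  -- In ρ' the ends of a sit at positions i₀ and a₂, those of b at b₁ and b₂.
  b₁ a₂ b₂ : ℕ
  b₁ = suc L
  a₂ = suc (suc L)
  b₂ = suc (suc (suc L))

  i₀≤L : i₀ ≤ L
  i₀≤L = m≤m+n i₀ z

  ρ'-length-< : ∀ {j} → j < suc b₂ → j < length ρ'
  ρ'-length-< {j} = subst (j <_) (sym length-ρ')

  ρ-length-< : ∀ {r} → r < L → r < length ρ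
  ρ-length-< {r} = subst (r <_) (sym length-ρ)

  label-P : ∀ j → j < i₀ → labelAt ρ' j ≡ labelAt ρ j
  label-P j j< = cong proj₂ (end-P j j<)

  label-Z : ∀ i → i < z → labelAt ρ' (suc (i₀ + i)) ≡ labelAt ρ (i₀ + i)
  label-Z i i< = cong proj₂ (end-Z i i<)

  fresh-P : ∀ {c} → (∀ r → r < length ρ → labelAt ρ r ≢ c) → ∀ j → j < i₀ → labelAt ρ' j ≢ c
  fresh-P fresh j j< eq = fresh j (ρ-length-< (<-≤-trans j< i₀≤L)) (trans (sym (label-P j j<)) eq)

  fresh-Z : ∀ {c} → (∀ r → r < length ρ → labelAt ρ r ≢ c) → ∀ i → i < z → labelAt ρ' (suc (i₀ + i)) ≢ c
  fresh-Z fresh i i< eq = fresh (i₀ + i) (ρ-length-< (+-monoʳ-< i₀ i<)) (trans (sym (label-Z i i<)) eq)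

  private
    i₀<b₁ : i₀ < b₁
    i₀<b₁ = s≤s i₀≤L
    b₁<a₂ : b₁ < a₂
    b₁<a₂ = n<1+n b₁
    a₂<b₂ : a₂ < b₂
    a₂<b₂ = n<1+n a₂
    b₂<len : b₂ < suc b₂
    b₂<len = n<1+n b₂

  label-a₁ : labelAt ρ' i₀ ≡ a
  label-a₁ = cong proj₂ end-a₁
  label-b₁ : labelAt ρ' b₁ ≡ b
  label-b₁ = cong proj₂ end-b₁
  label-a₂ : labelAt ρ' a₂ ≡ a
  label-a₂ = cong proj₂ end-a₂
  label-b₂ : labelAt ρ' b₂ ≡ b
  label-b₂ = cong proj₂ end-b₂

  partner-a₁ : partner ρ' i₀ ≡ a₂
  partner-a₁ = partner-≡ {ρ'} record
    { bound    = ρ'-length-< (<-trans a₂<b₂ b₂<len)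
    ; distinct = λ eq → <⇒≢ (<-trans i₀<b₁ b₁<a₂) (sym eq)
    ; hit      = trans label-a₂ (sym label-a₁)
    ; first    = λ j j< j≢ eq → earlier j j< j≢ (trans eq label-a₁) }
    where
    earlier : ∀ j → j < a₂ → j ≢ i₀ → labelAt ρ' j ≢ a
    earlier j j< j≢ with position j (<-trans j< (<-trans a₂<b₂ b₂<len))
    ... | in-P j<i₀        = fresh-P fresh-a j j<i₀
    ... | at-a₁ j≡i₀       = ⊥-elim (j≢ j≡i₀)
    ... | in-Z i i< refl   = fresh-Z fresh-a i i<
    ... | at-b₁ refl       = λ eq → a≢b (trans (sym eq) label-b₁)
    ... | at-a₂ refl       = ⊥-elim (<-irrefl refl j<)
    ... | at-b₂ refl       = ⊥-elim (<-asym j< a₂<b₂)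

  partner-a₂ : partner ρ' a₂ ≡ i₀
  partner-a₂ = partner-≡ {ρ'} record
    { bound    = ρ'-length-< (<-trans i₀<b₁ (<-trans b₁<a₂ (<-trans a₂<b₂ b₂<len)))
    ; distinct = λ eq → <⇒≢ (<-trans i₀<b₁ b₁<a₂) eq
    ; hit      = trans label-a₁ (sym label-a₂)
    ; first    = λ j j< _ eq → fresh-P fresh-a j j< (trans eq label-a₂) }

  partner-b₁ : partner ρ' b₁ ≡ b₂
  partner-b₁ = partner-≡ {ρ'} record
    { bound    = ρ'-length-< b₂<len
    ; distinct = λ eq → <⇒≢ (<-trans b₁<a₂ a₂<b₂) (sym eq)
    ; hit      = trans label-b₂ (sym label-b₁)
    ; first    = λ j j< j≢ eq → earlier j j< j≢ (trans eq label-b₁) }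
    where
    earlier : ∀ j → j < b₂ → j ≢ b₁ → labelAt ρ' j ≢ b
    earlier j j< j≢ with position j (<-trans j< b₂<len)
    ... | in-P j<i₀        = fresh-P fresh-b j j<i₀
    ... | at-a₁ refl       = λ eq → a≢b (trans (sym label-a₁) eq)
    ... | in-Z i i< refl   = fresh-Z fresh-b i i<
    ... | at-b₁ j≡b₁       = ⊥-elim (j≢ j≡b₁)
    ... | at-a₂ refl       = λ eq → a≢b (trans (sym label-a₂) eq)
    ... | at-b₂ refl       = ⊥-elim (<-irrefl refl j<)

  partner-b₂ : partner ρ' b₂ ≡ b₁
  partner-b₂ = partner-≡ {ρ'} record
    { bound    = ρ'-length-< (<-trans b₁<a₂ (<-trans a₂<b₂ b₂<len))
    ; distinct = λ eq → <⇒≢ (<-trans b₁<a₂ a₂<b₂) eq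
    ; hit      = trans label-b₁ (sym label-b₂)
    ; first    = λ j j< _ eq → earlier j j< (trans eq label-b₂) }
    where
    earlier : ∀ j → j < b₁ → labelAt ρ' j ≢ b
    earlier j j< with position j (<-trans j< (<-trans b₁<a₂ (<-trans a₂<b₂ b₂<len)))
    ... | in-P j<i₀        = fresh-P fresh-b j j<i₀
    ... | at-a₁ refl       = λ eq → a≢b (trans (sym label-a₁) eq)
    ... | in-Z i i< refl   = fresh-Z fresh-b i i<
    ... | at-b₁ refl       = ⊥-elim (<-irrefl refl j<)
    ... | at-a₂ refl       = ⊥-elim (<-asym j< b₁<a₂)
    ... | at-b₂ refl       = ⊥-elim (<-asym j< (<-trans b₁<a₂ a₂<b₂))

  shift : ℕ → ℕ
  shift r = if r <ᵇ i₀ then r else suc r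

  shift-P : ∀ {r} → r < i₀ → shift r ≡ r
  shift-P = if-< _ _

  shift-Z : ∀ {r} → i₀ ≤ r → shift r ≡ suc r
  shift-Z = if-≥ _ _

  shift-Z-index : ∀ i → shift (i₀ + i) ≡ suc (i₀ + i)
  shift-Z-index i = shift-Z (m≤m+n i₀ i)

  old-position : ∀ r → r < L → r < i₀ ⊎ Σ ℕ λ i → i < z × r ≡ i₀ + i
  old-position r r< with r <? i₀
  ... | yes r<i₀ = inj₁ r<i₀
  ... | no r≮i₀  = inj₂ (r ∸ i₀ , +-cancelˡ-< i₀ (r ∸ i₀) z (subst (_< L) (sym (m+[n∸m]≡n (≮⇒≥ r≮i₀))) r<) ,
                         sym (m+[n∸m]≡n (≮⇒≥ r≮i₀)))

  embedding : Embedding ρ ρ'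
  embedding = record
    { position        = shift
    ; position-closed = closed
    ; position-mono   = mono
    ; position-end    = end
    ; image-or-new    = image-or-new }
    where
    closed : ∀ r → r < length ρ → shift r < length ρ'
    closed r r< with old-position r (subst (r <_) length-ρ r<)
    ... | inj₁ r<i₀ rewrite shift-P r<i₀ =
      ρ'-length-< (<-trans (<-≤-trans r<i₀ i₀≤L) (<-trans (n<1+n L) (<-trans b₁<a₂ (<-trans a₂<b₂ b₂<len))))
    ... | inj₂ (i , i< , refl) rewrite shift-Z-index i =
      ρ'-length-< (<-trans (s≤s (+-monoʳ-< i₀ i<)) (<-trans b₁<a₂ (<-trans a₂<b₂ b₂<len)))
    mono : ∀ r s → r < length ρ → s < length ρ → r < s → shift r < shift s
    mono r s _ _ r<s with r <? i₀ | s <? i₀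
    ... | yes r<i₀ | yes s<i₀ rewrite shift-P r<i₀ | shift-P s<i₀ = r<s
    ... | yes r<i₀ | no s≮i₀ rewrite shift-P r<i₀ | shift-Z (≮⇒≥ s≮i₀) = <-trans r<s (n<1+n s)
    ... | no r≮i₀  | yes s<i₀ = ⊥-elim (r≮i₀ (<-trans r<s s<i₀))
    ... | no r≮i₀  | no s≮i₀ rewrite shift-Z (≮⇒≥ r≮i₀) | shift-Z (≮⇒≥ s≮i₀) = s≤s r<s
    end : ∀ r → r < length ρ → nth d₀ ρ' (shift r) ≡ nth d₀ ρ r
    end r r< with old-position r (subst (r <_) length-ρ r<)
    ... | inj₁ r<i₀ rewrite shift-P r<i₀ = end-P r r<i₀
    ... | inj₂ (i , i< , refl) rewrite shift-Z-index i = end-Z i i<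
    image-or-new : ∀ r' → r' < length ρ' → (Σ ℕ λ r → r < length ρ × shift r ≡ r')
                                          ⊎ (∀ r → r < length ρ → labelAt ρ' r' ≢ labelAt ρ r)
    image-or-new r' r'< with position r' (subst (r' <_) length-ρ' r'<)
    ... | in-P r'<i₀     = inj₁ (r' , ρ-length-< (<-≤-trans r'<i₀ i₀≤L) , shift-P r'<i₀)
    ... | in-Z i i< refl = inj₁ (i₀ + i , ρ-length-< (+-monoʳ-< i₀ i<) , shift-Z-index i)
    ... | at-a₁ refl     = inj₂ λ r r< eq → fresh-a r r< (trans (sym eq) label-a₁)
    ... | at-b₁ refl     = inj₂ λ r r< eq → fresh-b r r< (trans (sym eq) label-b₁)
    ... | at-a₂ refl     = inj₂ λ r r< eq → fresh-a r r< (trans (sym eq) label-a₂)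
    ... | at-b₂ refl     = inj₂ λ r r< eq → fresh-b r r< (trans (sym eq) label-b₂)

  module Emb = EmbeddingTheorem embedding pairing

  pairing' : IsPairing ρ'
  pairing' = Emb.isPairing-extend λ p p< → case p (position p (subst (p <_) length-ρ' p<))
    where
    case : ∀ p → Position p → (Σ ℕ λ r → r < length ρ × shift r ≡ p) ⊎ Emb.MateLaws p
    case p (in-P p<i₀)     = inj₁ (p , ρ-length-< (<-≤-trans p<i₀ i₀≤L) , shift-P p<i₀)
    case _ (in-Z i i< refl) = inj₁ (i₀ + i , ρ-length-< (+-monoʳ-< i₀ i<) , shift-Z-index i)
    case _ (at-a₁ refl) = inj₂ (Emb.mutual-mates (ρ'-length-< (<-trans a₂<b₂ b₂<len))
                                  (λ eq → <⇒≢ (<-trans i₀<b₁ b₁<a₂) (sym eq)) partner-a₁ partner-a₂)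
    case _ (at-a₂ refl) = inj₂ (Emb.mutual-mates (ρ'-length-< (<-trans i₀<b₁ (<-trans b₁<a₂ (<-trans a₂<b₂ b₂<len))))
                                  (λ eq → <⇒≢ (<-trans i₀<b₁ b₁<a₂) eq) partner-a₂ partner-a₁)
    case _ (at-b₁ refl) = inj₂ (Emb.mutual-mates (ρ'-length-< b₂<len)
                                  (λ eq → <⇒≢ (<-trans b₁<a₂ a₂<b₂) (sym eq)) partner-b₁ partner-b₂)
    case _ (at-b₂ refl) = inj₂ (Emb.mutual-mates (ρ'-length-< (<-trans b₁<a₂ (<-trans a₂<b₂ b₂<len)))
                                  (λ eq → <⇒≢ (<-trans b₁<a₂ a₂<b₂) eq) partner-b₂ partner-b₁)

  N N' : ℕ
  N  = 2 * L
  N' = 2 * suc b₂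

  α ε α' ε' : ℕ → ℕ
  α  = arcStep m
  ε  = edgeStep ρ
  α' = arcStep b₂
  ε' = edgeStep ρ'

  matchings : Matchings N α ε
  matchings = subst (λ k → Matchings (2 * suc k) (arcStep k) ε) (length-++ P) (rotation-matchings e (P ++ Z) pairing)

  matchings' : Matchings N' α' ε'
  matchings' = subst (λ k → Matchings (2 * suc k) (arcStep k) ε') (suc-injective length-ρ')
                     (rotation-matchings e (P ++ pos a ∷ Z ++ handleTail a b) pairing')

  -- pR is the right corner of the last end of e ∷ P, zL the new left corner of the first end of Z.
  pR last a₁L a₁R zL lastR b₁L b₁R a₂L a₂R b₂L b₂R : ℕ
  pR    = 2 * q + 1
  last  = 2 * m + 1
  a₁L   = 2 * i₀
  a₁R   = 2 * i₀ + 1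
  zL    = 2 * suc i₀
  lastR = 2 * L + 1
  b₁L   = 2 * b₁
  b₁R   = 2 * b₁ + 1
  a₂L   = 2 * a₂
  a₂R   = 2 * a₂ + 1
  b₂L   = 2 * b₂
  b₂R   = 2 * b₂ + 1

  private
    q<b₂ : q < b₂
    q<b₂ = <-trans (s≤s (m≤m+n q z)) (<-trans (n<1+n L) (<-trans b₁<a₂ a₂<b₂))
    i₀<b₂ : i₀ < b₂
    i₀<b₂ = <-trans i₀<b₁ (<-trans b₁<a₂ a₂<b₂)
    L<b₂ : L < b₂
    L<b₂ = <-trans (n<1+n L) (<-trans b₁<a₂ a₂<b₂)
    <b₂⇒<sb₂ : ∀ {r} → r < b₂ → r < suc b₂
    <b₂⇒<sb₂ r< = <-trans r< (n<1+n b₂)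

  α'-0 : α' 0 ≡ b₂R
  α'-0 = arcStep-first b₂
  α'-b₂R : α' b₂R ≡ 0
  α'-b₂R = arcStep-last b₂
  α'-a₁L : α' a₁L ≡ pR
  α'-a₁L = arcStep-left-suc b₂ q (<b₂⇒<sb₂ q<b₂)
  α'-pR : α' pR ≡ a₁L
  α'-pR = arcStep-right-< b₂ q q<b₂
  α'-a₁R : α' a₁R ≡ zL
  α'-a₁R = arcStep-right-< b₂ i₀ i₀<b₂
  α'-zL : α' zL ≡ a₁R
  α'-zL = arcStep-left-suc b₂ i₀ (<b₂⇒<sb₂ i₀<b₂)
  α'-b₁L : α' b₁L ≡ lastR
  α'-b₁L = arcStep-left-suc b₂ L (<b₂⇒<sb₂ L<b₂)
  α'-lastR : α' lastR ≡ b₁L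
  α'-lastR = arcStep-right-< b₂ L L<b₂
  α'-b₁R : α' b₁R ≡ a₂L
  α'-b₁R = arcStep-right-< b₂ b₁ (<-trans b₁<a₂ a₂<b₂)
  α'-a₂L : α' a₂L ≡ b₁R
  α'-a₂L = arcStep-left-suc b₂ b₁ (<b₂⇒<sb₂ (<-trans b₁<a₂ a₂<b₂))
  α'-a₂R : α' a₂R ≡ b₂L
  α'-a₂R = arcStep-right-< b₂ a₂ a₂<b₂
  α'-b₂L : α' b₂L ≡ a₂R
  α'-b₂L = arcStep-left-suc b₂ a₂ (<b₂⇒<sb₂ a₂<b₂)

  α-0 : α 0 ≡ last
  α-0 = arcStep-first m
  α-last : α last ≡ 0
  α-last = arcStep-last m
  α-a₁L : α a₁L ≡ pR
  α-a₁L = arcStep-left-suc m q (s≤s (m≤m+n q z))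
  α-pR : q < m → α pR ≡ a₁L
  α-pR = arcStep-right-< m q

  sign-new : ∀ j {c} → nth d₀ ρ' j ≡ pos c → signAt ρ' j ≡ true
  sign-new j eq = cong proj₁ eq

  untwisted-a₁ : untwisted ρ' i₀ ≡ true
  untwisted-a₁ = cong₂ sameSign (sign-new i₀ end-a₁) (trans (cong (signAt ρ') partner-a₁) (sign-new a₂ end-a₂))
  untwisted-a₂ : untwisted ρ' a₂ ≡ true
  untwisted-a₂ = cong₂ sameSign (sign-new a₂ end-a₂) (trans (cong (signAt ρ') partner-a₂) (sign-new i₀ end-a₁))
  untwisted-b₁ : untwisted ρ' b₁ ≡ true
  untwisted-b₁ = cong₂ sameSign (sign-new b₁ end-b₁) (trans (cong (signAt ρ') partner-b₁) (sign-new b₂ end-b₂))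
  untwisted-b₂ : untwisted ρ' b₂ ≡ true
  untwisted-b₂ = cong₂ sameSign (sign-new b₂ end-b₂) (trans (cong (signAt ρ') partner-b₂) (sign-new b₁ end-b₁))

  ε'-a₁L : ε' a₁L ≡ a₂R
  ε'-a₁L rewrite edgeStep-left ρ' i₀ | untwisted-a₁ | partner-a₁ = refl
  ε'-a₁R : ε' a₁R ≡ a₂L
  ε'-a₁R rewrite edgeStep-right ρ' i₀ | untwisted-a₁ | partner-a₁ = refl
  ε'-a₂L : ε' a₂L ≡ a₁R
  ε'-a₂L rewrite edgeStep-left ρ' a₂ | untwisted-a₂ | partner-a₂ = refl
  ε'-a₂R : ε' a₂R ≡ a₁L
  ε'-a₂R rewrite edgeStep-right ρ' a₂ | untwisted-a₂ | partner-a₂ = refl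
  ε'-b₁L : ε' b₁L ≡ b₂R
  ε'-b₁L rewrite edgeStep-left ρ' b₁ | untwisted-b₁ | partner-b₁ = refl
  ε'-b₁R : ε' b₁R ≡ b₂L
  ε'-b₁R rewrite edgeStep-right ρ' b₁ | untwisted-b₁ | partner-b₁ = refl
  ε'-b₂L : ε' b₂L ≡ b₁R
  ε'-b₂L rewrite edgeStep-left ρ' b₂ | untwisted-b₂ | partner-b₂ = refl
  ε'-b₂R : ε' b₂R ≡ b₁L
  ε'-b₂R rewrite edgeStep-right ρ' b₂ | untwisted-b₂ | partner-b₂ = refl

  embed : ℕ → ℕ
  embed x = if x <ᵇ a₁L then x else 2 + x

  embed-P : ∀ {x} → x < a₁L → embed x ≡ x
  embed-P = if-< _ _
  embed-Z : ∀ {x} → a₁L ≤ x → embed x ≡ 2 + x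
  embed-Z = if-≥ _ _

  embed-left : ∀ r → r < length ρ → embed (2 * r) ≡ 2 * shift r
  embed-left r _ with r <? i₀
  ... | yes r<i₀ = trans (embed-P (left-< r<i₀)) (cong (2 *_) (sym (shift-P r<i₀)))
  ... | no r≮i₀  = trans (embed-Z (left-≤ (≮⇒≥ r≮i₀)))
                         (trans (sym (*-suc 2 r)) (cong (2 *_) (sym (shift-Z (≮⇒≥ r≮i₀)))))

  embed-right : ∀ r → r < length ρ → embed (2 * r + 1) ≡ 2 * shift r + 1
  embed-right r _ with r <? i₀
  ... | yes r<i₀ = trans (embed-P (right-< r<i₀)) (cong (λ k → 2 * k + 1) (sym (shift-P r<i₀)))
  ... | no r≮i₀  = trans (embed-Z (≤-trans (left-≤ (≮⇒≥ r≮i₀)) (m≤m+n _ 1)))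
                         (trans (cong (_+ 1) (sym (*-suc 2 r))) (cong (λ k → 2 * k + 1) (sym (shift-Z (≮⇒≥ r≮i₀)))))

  ε'-embed : ∀ x → x < N → ε' (embed x) ≡ embed (ε x)
  ε'-embed x x< = Emb.edgeStep-embed embed embed-left embed-right x (subst (x <_) (sym (cong (2 *_) length-ρ)) x<)

  retract : ℕ → ℕ
  retract u = if u <ᵇ a₁L then u
              else if u <ᵇ a₁L + 2 then pR
              else if u <ᵇ N + 2 then u ∸ 2
              else if (u ≡ᵇ b₁L) ∨ (u ≡ᵇ b₂R) then 0 else pR

  a₁L≤N : a₁L ≤ N
  a₁L≤N = left-≤ i₀≤L

  N+2≡b₁L : N + 2 ≡ b₁L
  N+2≡b₁L = trans (+-comm N 2) (sym (*-suc 2 L))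

  retract-P : ∀ {u} → u < a₁L → retract u ≡ u
  retract-P = if-< _ _

  retract-a₁ : ∀ {u} → a₁L ≤ u → u < a₁L + 2 → retract u ≡ pR
  retract-a₁ h₁ h₂ = trans (if-≥ _ _ h₁) (if-< _ _ h₂)

  retract-Z : ∀ {u} → a₁L + 2 ≤ u → u < N + 2 → retract u ≡ u ∸ 2
  retract-Z h₁ h₂ = trans (if-≥ _ _ (≤-trans (m≤m+n a₁L 2) h₁)) (trans (if-≥ _ _ h₁) (if-< _ _ h₂))

  retract-handle : ∀ {u} → b₁L ≤ u → retract u ≡ (if (u ≡ᵇ b₁L) ∨ (u ≡ᵇ b₂R) then 0 else pR)
  retract-handle {u} h = trans (if-≥ _ _ (≤-trans (≤-trans a₁L≤N (m≤m+n N 2)) h'))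
    (trans (if-≥ _ _ (≤-trans (+-monoˡ-≤ 2 a₁L≤N) h')) (if-≥ _ _ h'))
    where h' = subst (_≤ u) (sym N+2≡b₁L) h

  retract-embed : ∀ x → x < N → retract (embed x) ≡ x
  retract-embed x x< with x <? a₁L
  ... | yes x<a₁L = trans (cong retract (embed-P x<a₁L)) (retract-P x<a₁L)
  ... | no x≮a₁L  = trans (cong retract (embed-Z (≮⇒≥ x≮a₁L)))
    (retract-Z (subst (_≤ 2 + x) (+-comm 2 a₁L) (s≤s (s≤s (≮⇒≥ x≮a₁L))))
               (subst (2 + x <_) (+-comm 2 N) (s≤s (s≤s x<))))

  private
    b₁L≤L : ∀ {k} → b₁ ≤ k → b₁L ≤ 2 * k
    b₁L≤L = left-≤
    b₁L≤R : ∀ {k} → b₁ ≤ k → b₁L ≤ 2 * k + 1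
    b₁L≤R h = ≤-trans (left-≤ h) (m≤m+n _ 1)

  retract-b₁L : retract b₁L ≡ 0
  retract-b₁L rewrite retract-handle {b₁L} ≤-refl | ≡⇒≡ᵇ≡true {b₁L} refl = refl

  retract-b₂R : retract b₂R ≡ 0
  retract-b₂R rewrite retract-handle {b₂R} (b₁L≤R (<⇒≤ (<-trans b₁<a₂ a₂<b₂)))
                    | ≢⇒≡ᵇ≡false {b₂R} {b₁L} (λ eq → left≢right b₁ b₂ (sym eq)) | ≡⇒≡ᵇ≡true {b₂R} refl = refl

  retract-handle-pR : ∀ {u} → b₁L ≤ u → u ≢ b₁L → u ≢ b₂R → retract u ≡ pR
  retract-handle-pR {u} h ne₁ ne₂ rewrite retract-handle h | ≢⇒≡ᵇ≡false ne₁ | ≢⇒≡ᵇ≡false ne₂ = refl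

  retract-b₁R : retract b₁R ≡ pR
  retract-b₁R = retract-handle-pR (b₁L≤R ≤-refl) (λ eq → left≢right b₁ b₁ (sym eq))
                                  (λ eq → <⇒≢ (<-trans b₁<a₂ a₂<b₂) (right-injective eq))
  retract-a₂L : retract a₂L ≡ pR
  retract-a₂L = retract-handle-pR (b₁L≤L (<⇒≤ b₁<a₂)) (λ eq → <⇒≢ b₁<a₂ (sym (left-injective eq)))
                                  (λ eq → left≢right a₂ b₂ eq)
  retract-a₂R : retract a₂R ≡ pR
  retract-a₂R = retract-handle-pR (b₁L≤R (<⇒≤ b₁<a₂)) (λ eq → left≢right b₁ a₂ (sym eq))
                                  (λ eq → <⇒≢ a₂<b₂ (right-injective eq))
  retract-b₂L : retract b₂L ≡ pR
  retract-b₂L = retract-handle-pR (b₁L≤L (<⇒≤ (<-trans b₁<a₂ a₂<b₂)))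
                                  (λ eq → <⇒≢ (<-trans b₁<a₂ a₂<b₂) (sym (left-injective eq)))
                                  (λ eq → left≢right b₂ b₂ eq)

  retract-a₁L : retract a₁L ≡ pR
  retract-a₁L = retract-a₁ ≤-refl (subst (a₁L <_) (+-comm 2 a₁L) (s≤s (n≤1+n a₁L)))
  retract-a₁R : retract a₁R ≡ pR
  retract-a₁R = retract-a₁ (m≤m+n a₁L 1) (+-monoʳ-< a₁L (s≤s (s≤s z≤n)))

  data ArcCase (x : ℕ) : Set where
    at-0      : x ≡ 0 → ArcCase x
    at-pR     : x ≡ pR → ArcCase x
    at-Z      : q < m → x ≡ a₁L → ArcCase x
    at-last   : q < m → x ≡ last → ArcCase x
    unchanged : α' (embed x) ≡ embed (α x) → ArcCase x

  α'-embed-left-P : ∀ r → suc r < i₀ → α' (embed (2 * suc r)) ≡ embed (α (2 * suc r))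
  α'-embed-left-P r r+1<i₀ = begin
    α' (embed (2 * suc r))  ≡⟨ cong α' (embed-P (left-< r+1<i₀)) ⟩
    α' (2 * suc r)          ≡⟨ arcStep-left-suc b₂ r (<-trans r<L (<b₂⇒<sb₂ L<b₂)) ⟩
    2 * r + 1               ≡⟨ sym (embed-P (right-< (<-trans (n<1+n r) r+1<i₀))) ⟩
    embed (2 * r + 1)       ≡⟨ cong embed (sym (arcStep-left-suc m r r<L)) ⟩
    embed (α (2 * suc r))   ∎
    where
    open ≡-Reasoning
    r<L = <-trans (n<1+n r) (<-≤-trans r+1<i₀ i₀≤L)

  α'-embed-left-Z : ∀ r → i₀ < suc r → suc r < L → α' (embed (2 * suc r)) ≡ embed (α (2 * suc r))
  α'-embed-left-Z r i₀<r+1 r+1<L = begin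
    α' (embed (2 * suc r))  ≡⟨ cong α' (trans (embed-Z (left-≤ (<⇒≤ i₀<r+1))) (sym (*-suc 2 (suc r)))) ⟩
    α' (2 * suc (suc r))    ≡⟨ arcStep-left-suc b₂ (suc r) (<-trans r+1<L (<b₂⇒<sb₂ L<b₂)) ⟩
    2 * suc r + 1           ≡⟨ cong (_+ 1) (*-suc 2 r) ⟩
    2 + (2 * r + 1)         ≡⟨ sym (embed-Z (≤-trans (left-≤ (s≤s⁻¹ i₀<r+1)) (m≤m+n _ 1))) ⟩
    embed (2 * r + 1)       ≡⟨ cong embed (sym (arcStep-left-suc m r (<-trans (n<1+n r) r+1<L))) ⟩
    embed (α (2 * suc r))   ∎
    where open ≡-Reasoning

  α'-embed-right-P : ∀ r → r < q → α' (embed (2 * r + 1)) ≡ embed (α (2 * r + 1))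
  α'-embed-right-P r r<q = begin
    α' (embed (2 * r + 1))  ≡⟨ cong α' (embed-P (right-< (<-trans r<q (n<1+n q)))) ⟩
    α' (2 * r + 1)          ≡⟨ arcStep-right-< b₂ r (<-trans r<q q<b₂) ⟩
    2 * suc r               ≡⟨ sym (embed-P (left-< (s≤s r<q))) ⟩
    embed (2 * suc r)       ≡⟨ cong embed (sym (arcStep-right-< m r (≤-trans r<q (m≤m+n q z)))) ⟩
    embed (α (2 * r + 1))   ∎
    where open ≡-Reasoning

  α'-embed-right-Z : ∀ r → q < r → r < m → α' (embed (2 * r + 1)) ≡ embed (α (2 * r + 1))
  α'-embed-right-Z r q<r r<m = begin
    α' (embed (2 * r + 1))  ≡⟨ cong α' (trans (embed-Z (≤-trans (left-≤ q<r) (m≤m+n _ 1))) (cong (_+ 1) (sym (*-suc 2 r)))) ⟩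
    α' (2 * suc r + 1)      ≡⟨ arcStep-right-< b₂ (suc r) (<-trans (s≤s r<m) L<b₂) ⟩
    2 * suc (suc r)         ≡⟨ *-suc 2 (suc r) ⟩
    2 + 2 * suc r           ≡⟨ sym (embed-Z (left-≤ (<⇒≤ (s≤s q<r)))) ⟩
    embed (2 * suc r)       ≡⟨ cong embed (sym (arcStep-right-< m r r<m)) ⟩
    embed (α (2 * r + 1))   ∎
    where open ≡-Reasoning

  arcCase : ∀ x → x < N → ArcCase x
  arcCase x x< with corner x
  ... | left zero = at-0 refl
  ... | left (suc r) with <-cmp (suc r) i₀
  ...   | tri< r+1<i₀ _ _ = unchanged (α'-embed-left-P r r+1<i₀)
  ...   | tri≈ _ r+1≡i₀ _ = at-Z (subst (_< m) (suc-injective r+1≡i₀) (s≤s⁻¹ (left-<⁻ L x<))) (cong (2 *_) r+1≡i₀)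
  ...   | tri> _ _ i₀<r+1 = unchanged (α'-embed-left-Z r i₀<r+1 (left-<⁻ L x<))
  arcCase x x< | right r with <-cmp r q
  ...   | tri< r<q _ _ = unchanged (α'-embed-right-P r r<q)
  ...   | tri≈ _ r≡q _ = at-pR (cong (λ k → 2 * k + 1) r≡q)
  ...   | tri> _ _ q<r with m≤n⇒m<n∨m≡n {r} {m} (s≤s⁻¹ (right-<⁻ L x<))
  ...     | inj₁ r<m = unchanged (α'-embed-right-Z r q<r r<m)
  ...     | inj₂ r≡m = at-last (subst (q <_) r≡m q<r) (cong (λ k → 2 * k + 1) r≡m)

  data NewCorner (u : ℕ) : Set where
    image : ∀ x → x < N → u ≡ embed x → NewCorner u
    is-a₁L : u ≡ a₁L → NewCorner u
    is-a₁R : u ≡ a₁R → NewCorner u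
    is-b₁L : u ≡ b₁L → NewCorner u
    is-b₁R : u ≡ b₁R → NewCorner u
    is-a₂L : u ≡ a₂L → NewCorner u
    is-a₂R : u ≡ a₂R → NewCorner u
    is-b₂L : u ≡ b₂L → NewCorner u
    is-b₂R : u ≡ b₂R → NewCorner u

  newCorner : ∀ u → u < N' → NewCorner u
  newCorner u u< with corner u
  ... | left r with position r (left-<⁻ (suc b₂) u<)
  ...   | in-P r<i₀ = image (2 * r) (left-< (<-≤-trans r<i₀ i₀≤L)) (sym (embed-P (left-< r<i₀)))
  ...   | in-Z i i< refl = image (2 * (i₀ + i)) (left-< (+-monoʳ-< i₀ i<))
          (sym (trans (embed-Z (left-≤ (m≤m+n i₀ i))) (sym (*-suc 2 (i₀ + i)))))
  ...   | at-a₁ refl = is-a₁L refl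
  ...   | at-b₁ refl = is-b₁L refl
  ...   | at-a₂ refl = is-a₂L refl
  ...   | at-b₂ refl = is-b₂L refl
  newCorner u u< | right r with position r (right-<⁻ (suc b₂) u<)
  ...   | in-P r<i₀ = image (2 * r + 1) (right-< (<-≤-trans r<i₀ i₀≤L)) (sym (embed-P (right-< r<i₀)))
  ...   | in-Z i i< refl = image (2 * (i₀ + i) + 1) (right-< (+-monoʳ-< i₀ i<))
          (sym (trans (embed-Z (≤-trans (left-≤ (m≤m+n i₀ i)) (m≤m+n _ 1))) (cong (_+ 1) (sym (*-suc 2 (i₀ + i))))))
  ...   | at-a₁ refl = is-a₁R refl
  ...   | at-b₁ refl = is-b₁R refl
  ...   | at-a₂ refl = is-a₂R refl
  ...   | at-b₂ refl = is-b₂R refl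

  R' : ℕ → ℕ → Set
  R' = Reach α' ε'

  path-a₁L : R' a₁L pR
  path-a₁L = here ▸α α'-a₁L
  path-a₂R : R' a₂R pR
  path-a₂R = here ▸ε ε'-a₂R ▸α α'-a₁L
  path-b₂L : R' b₂L pR
  path-b₂L = here ▸α α'-b₂L ▸ε ε'-a₂R ▸α α'-a₁L
  path-b₁R : R' b₁R pR
  path-b₁R = here ▸ε ε'-b₁R ▸α α'-b₂L ▸ε ε'-a₂R ▸α α'-a₁L
  path-a₂L : R' a₂L pR
  path-a₂L = here ▸α α'-a₂L ▸ε ε'-b₁R ▸α α'-b₂L ▸ε ε'-a₂R ▸α α'-a₁L
  path-a₁R : R' a₁R pR
  path-a₁R = here ▸ε ε'-a₁R ▸α α'-a₂L ▸ε ε'-b₁R ▸α α'-b₂L ▸ε ε'-a₂R ▸α α'-a₁L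
  path-b₁L : R' b₁L 0
  path-b₁L = here ▸ε ε'-b₁L ▸α α'-b₂R
  path-b₂R : R' b₂R 0
  path-b₂R = here ▸α α'-b₂R
  path-0 : R' 0 lastR
  path-0 = here ▸α α'-0 ▸ε ε'-b₂R ▸α α'-b₁L

  pR<a₁L : pR < a₁L
  pR<a₁L = right-< (n<1+n q)
  pR<N : pR < N
  pR<N = <-≤-trans pR<a₁L a₁L≤N

  embed-0 : embed 0 ≡ 0
  embed-0 = embed-P (≤-trans (s≤s z≤n) pR<a₁L)
  embed-pR : embed pR ≡ pR
  embed-pR = embed-P pR<a₁L
  retract-0 : retract 0 ≡ 0
  retract-0 = retract-P (≤-trans (s≤s z≤n) pR<a₁L)
  retract-pR : retract pR ≡ pR
  retract-pR = retract-P pR<a₁L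

  data ZCase : Set where
    nonempty : q < m → ZCase
    empty    : m ≡ q → ZCase

  zCase : ZCase
  zCase with q <? m
  ... | yes q<m = nonempty q<m
  ... | no q≮m  = empty (≤-antisym (≮⇒≥ q≮m) (m≤m+n q z))

  module Nonempty (q<m : q < m) where
    embed-a₁L : embed a₁L ≡ zL
    embed-a₁L = trans (embed-Z ≤-refl) (sym (*-suc 2 i₀))
    embed-last : embed last ≡ lastR
    embed-last = trans (embed-Z (≤-trans (left-≤ q<m) (m≤m+n _ 1))) (cong (_+ 1) (sym (*-suc 2 m)))
    retract-zL : retract zL ≡ a₁L
    retract-zL = trans (cong retract (sym embed-a₁L)) (retract-embed a₁L (left-< (s≤s q<m)))
    retract-lastR : retract lastR ≡ last
    retract-lastR = trans (cong retract (sym embed-last)) (retract-embed last (right-< (n<1+n m)))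

  module Empty (m≡q : m ≡ q) where
    last≡pR : last ≡ pR
    last≡pR = cong (λ k → 2 * k + 1) m≡q
    lastR≡a₁R : lastR ≡ a₁R
    lastR≡a₁R = cong (λ k → 2 * suc k + 1) m≡q
    b₁L≡zL : b₁L ≡ zL
    b₁L≡zL = cong (λ k → 2 * suc (suc k)) m≡q
    embed-last : embed last ≡ pR
    embed-last = trans (cong embed last≡pR) embed-pR
    retract-zL : retract zL ≡ 0
    retract-zL = trans (cong retract (sym b₁L≡zL)) retract-b₁L
    retract-lastR : retract lastR ≡ last
    retract-lastR = trans (cong retract lastR≡a₁R) (trans retract-a₁R (sym last≡pR))

  retract-lastR : retract lastR ≡ last
  retract-lastR with zCase
  ... | nonempty q<m = Nonempty.retract-lastR q<m
  ... | empty m≡q    = Empty.retract-lastR m≡q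

  α-pR-empty : m ≡ q → α pR ≡ 0
  α-pR-empty m≡q = trans (cong α (sym (Empty.last≡pR m≡q))) α-last

  -- Every inserted corner lies on a path of new corners ending at pR or at 0.
  record Inserted (u : ℕ) : Set where
    field
      bound      : u < N'
      retract-to : retract u ≡ pR ⊎ retract u ≡ 0
      path       : R' u (embed (retract u))
      above      : embed (retract u) < u

  via-pR : ∀ {u} → retract u ≡ pR → R' u pR → a₁L ≤ u → u < N' → Inserted u
  via-pR {u} eq r a₁L≤u u< = record
    { bound = u< ; retract-to = inj₁ eq
    ; path  = subst (R' u) (sym (trans (cong embed eq) embed-pR)) r
    ; above = subst (_< u) (sym (trans (cong embed eq) embed-pR)) (<-≤-trans pR<a₁L a₁L≤u) }

  via-0 : ∀ {u} → retract u ≡ 0 → R' u 0 → 0 < u → u < N' → Inserted u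
  via-0 {u} eq r 0<u u< = record
    { bound = u< ; retract-to = inj₂ eq
    ; path  = subst (R' u) (sym (trans (cong embed eq) embed-0)) r
    ; above = subst (_< u) (sym (trans (cong embed eq) embed-0)) 0<u }

  private
    i₀≤b₁ = <⇒≤ i₀<b₁
    i₀≤a₂ = ≤-trans i₀≤b₁ (<⇒≤ b₁<a₂)
    i₀≤b₂ = <⇒≤ i₀<b₂
    a₁L≤R : ∀ {k} → i₀ ≤ k → a₁L ≤ 2 * k + 1
    a₁L≤R h = ≤-trans (left-≤ h) (m≤m+n _ 1)
    <N' : ∀ {k} → k < suc b₂ → 2 * k < N'
    <N' = left-<
    <N'ʳ : ∀ {k} → k < suc b₂ → 2 * k + 1 < N'
    <N'ʳ = right-<

  inserted-a₁L : Inserted a₁L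
  inserted-a₁L = via-pR retract-a₁L path-a₁L ≤-refl (<N' (<-trans i₀<b₂ (n<1+n b₂)))
  inserted-a₁R : Inserted a₁R
  inserted-a₁R = via-pR retract-a₁R path-a₁R (a₁L≤R ≤-refl) (<N'ʳ (<-trans i₀<b₂ (n<1+n b₂)))
  inserted-b₁L : Inserted b₁L
  inserted-b₁L = via-0 retract-b₁L path-b₁L (≤-trans (s≤s z≤n) (≤-reflexive N+2≡b₁L)) (<N' (<b₂⇒<sb₂ (<-trans b₁<a₂ a₂<b₂)))
  inserted-b₁R : Inserted b₁R
  inserted-b₁R = via-pR retract-b₁R path-b₁R (a₁L≤R i₀≤b₁) (<N'ʳ (<b₂⇒<sb₂ (<-trans b₁<a₂ a₂<b₂)))
  inserted-a₂L : Inserted a₂L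
  inserted-a₂L = via-pR retract-a₂L path-a₂L (left-≤ i₀≤a₂) (<N' (<b₂⇒<sb₂ a₂<b₂))
  inserted-a₂R : Inserted a₂R
  inserted-a₂R = via-pR retract-a₂R path-a₂R (a₁L≤R i₀≤a₂) (<N'ʳ (<b₂⇒<sb₂ a₂<b₂))
  inserted-b₂L : Inserted b₂L
  inserted-b₂L = via-pR retract-b₂L path-b₂L (left-≤ i₀≤b₂) (<N' (n<1+n b₂))
  inserted-b₂R : Inserted b₂R
  inserted-b₂R = via-0 retract-b₂R path-b₂R (s≤s z≤n) (<N'ʳ (n<1+n b₂))

  data Kind (u : ℕ) : Set where
    embedded : ∀ x → x < N → u ≡ embed x → Kind u
    inserted : Inserted u → Kind u

  kind : ∀ u → u < N' → Kind u
  kind u u< with newCorner u u<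
  ... | image x x< eq = embedded x x< eq
  ... | is-a₁L refl = inserted inserted-a₁L
  ... | is-a₁R refl = inserted inserted-a₁R
  ... | is-b₁L refl = inserted inserted-b₁L
  ... | is-b₁R refl = inserted inserted-b₁R
  ... | is-a₂L refl = inserted inserted-a₂L
  ... | is-a₂R refl = inserted inserted-a₂R
  ... | is-b₂L refl = inserted inserted-b₂L
  ... | is-b₂R refl = inserted inserted-b₂R

  module O' = Orbits matchings'

  a₁R<N' : a₁R < N'
  a₁R<N' = right-< (<-trans i₀<b₂ (n<1+n b₂))

  embed-α : ∀ x → x < N → R' (embed x) (embed (α x))
  embed-α x x< with arcCase x x<
  ... | unchanged eq = here ▸α eq
  ... | at-0 refl with zCase
  ...   | nonempty q<m = reach-trans (reach-≡ embed-0)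
                           (subst (R' 0) (sym (trans (cong embed α-0) (Nonempty.embed-last q<m))) path-0)
  ...   | empty m≡q    = reach-trans (reach-≡ embed-0) (reach-trans (subst (R' 0) (Empty.lastR≡a₁R m≡q) path-0)
                           (subst (R' a₁R) (sym (trans (cong embed α-0) (Empty.embed-last m≡q))) path-a₁R))
  embed-α x x< | at-pR refl with zCase
  ...   | nonempty q<m = reach-trans (reach-≡ embed-pR) (reach-trans (O'.reach-sym a₁R<N' path-a₁R)
                           (here ▸α trans α'-a₁R (sym (trans (cong embed (α-pR q<m)) (Nonempty.embed-a₁L q<m)))))
  ...   | empty m≡q    = reach-trans (reach-≡ embed-pR) (reach-trans (O'.reach-sym a₁R<N' path-a₁R)
                           (reach-trans (reach-≡ (sym (Empty.lastR≡a₁R m≡q)) ▸α α'-lastR)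
                             (subst (R' b₁L) (sym (trans (cong embed (α-pR-empty m≡q)) embed-0)) path-b₁L)))
  embed-α x x< | at-Z q<m refl = reach-trans (reach-≡ (Nonempty.embed-a₁L q<m) ▸α α'-zL)
                                   (subst (R' a₁R) (sym (trans (cong embed α-a₁L) embed-pR)) path-a₁R)
  embed-α x x< | at-last q<m refl = reach-trans (reach-≡ (Nonempty.embed-last q<m) ▸α α'-lastR)
                                      (subst (R' b₁L) (sym (trans (cong embed α-last) embed-0)) path-b₁L)

  stay : ∀ {x y c} → x ≡ c → y ≡ c → Reach α ε x y
  stay x≡c y≡c = reach-≡ (trans x≡c (sym y≡c))

  retract-α-embedded : ∀ x → x < N → ArcCase x → Reach α ε x (retract (α' (embed x)))
  retract-α-embedded x x< (unchanged eq) =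
    here ▸α sym (trans (cong retract eq) (retract-embed (α x) (IsMatching.closed (Matchings.arcs matchings) x x<)))
  retract-α-embedded .0 _ (at-0 refl) =
    reach-≡ (sym (trans (cong (retract ∘ α') embed-0) (trans (cong retract α'-0) retract-b₂R)))
  retract-α-embedded .pR _ (at-pR refl) =
    reach-≡ (sym (trans (cong (retract ∘ α') embed-pR) (trans (cong retract α'-pR) retract-a₁L)))
  retract-α-embedded .a₁L _ (at-Z q<m refl) =
    here ▸α trans α-a₁L (sym (trans (cong (retract ∘ α') (Nonempty.embed-a₁L q<m))
                                    (trans (cong retract α'-zL) retract-a₁R)))
  retract-α-embedded .last _ (at-last q<m refl) =
    here ▸α trans α-last (sym (trans (cong (retract ∘ α') (Nonempty.embed-last q<m))
                                     (trans (cong retract α'-lastR) retract-b₁L)))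

  retract-α : ∀ u → u < N' → Reach α ε (retract u) (retract (α' u))
  retract-α u u< with newCorner u u<
  ... | image x x< refl = reach-trans (reach-≡ (retract-embed x x<)) (retract-α-embedded x x< (arcCase x x<))
  ... | is-a₁L refl = stay retract-a₁L (trans (cong retract α'-a₁L) retract-pR)
  ... | is-b₁L refl = reach-≡ retract-b₁L ▸α trans α-0 (sym (trans (cong retract α'-b₁L) retract-lastR))
  ... | is-b₁R refl = stay retract-b₁R (trans (cong retract α'-b₁R) retract-a₂L)
  ... | is-a₂L refl = stay retract-a₂L (trans (cong retract α'-a₂L) retract-b₁R)
  ... | is-a₂R refl = stay retract-a₂R (trans (cong retract α'-a₂R) retract-b₂L)
  ... | is-b₂L refl = stay retract-b₂L (trans (cong retract α'-b₂L) retract-a₂R)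
  ... | is-b₂R refl = stay retract-b₂R (trans (cong retract α'-b₂R) retract-0)
  ... | is-a₁R refl with zCase
  ...   | nonempty q<m = reach-≡ retract-a₁R
                           ▸α trans (α-pR q<m) (sym (trans (cong retract α'-a₁R) (Nonempty.retract-zL q<m)))
  ...   | empty m≡q    = reach-≡ retract-a₁R
                           ▸α trans (α-pR-empty m≡q) (sym (trans (cong retract α'-a₁R) (Empty.retract-zL m≡q)))

  retract-ε : ∀ u → u < N' → Reach α ε (retract u) (retract (ε' u))
  retract-ε u u< with newCorner u u<
  ... | image x x< refl = reach-trans (reach-≡ (retract-embed x x<))
    (here ▸ε sym (trans (cong retract (ε'-embed x x<))
                        (retract-embed (ε x) (IsMatching.closed (Matchings.sides matchings) x x<))))
  ... | is-a₁L refl = stay retract-a₁L (trans (cong retract ε'-a₁L) retract-a₂R)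
  ... | is-a₁R refl = stay retract-a₁R (trans (cong retract ε'-a₁R) retract-a₂L)
  ... | is-b₁L refl = stay retract-b₁L (trans (cong retract ε'-b₁L) retract-b₂R)
  ... | is-b₁R refl = stay retract-b₁R (trans (cong retract ε'-b₁R) retract-b₂L)
  ... | is-a₂L refl = stay retract-a₂L (trans (cong retract ε'-a₂L) retract-a₁R)
  ... | is-a₂R refl = stay retract-a₂R (trans (cong retract ε'-a₂R) retract-a₁L)
  ... | is-b₂L refl = stay retract-b₂L (trans (cong retract ε'-b₂L) retract-b₁R)
  ... | is-b₂R refl = stay retract-b₂R (trans (cong retract ε'-b₂R) retract-b₁L)

  embed-closed : ∀ x → x < N → embed x < N'
  embed-closed x x< with x <? a₁L
  ... | yes x<a₁L = subst (_< N') (sym (embed-P x<a₁L))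
                          (<-trans x< (left-< (<-trans (n<1+n L) (<b₂⇒<sb₂ (<-trans b₁<a₂ a₂<b₂)))))
  ... | no x≮a₁L  = subst (_< N') (sym (embed-Z (≮⇒≥ x≮a₁L)))
                          (≤-trans (s≤s (s≤s x<))
                            (≤-trans (≤-reflexive (sym (*-suc 2 L))) (left-≤ (<⇒≤ (<b₂⇒<sb₂ (<-trans b₁<a₂ a₂<b₂))))))
  embed-mono : ∀ x y → x < N → y < N → x < y → embed x < embed y
  embed-mono x y _ _ x<y with x <? a₁L | y <? a₁L
  ... | yes x< | yes y< rewrite embed-P x< | embed-P y< = x<y
  ... | yes x< | no y≮  rewrite embed-P x< | embed-Z (≮⇒≥ y≮) = <-trans x<y (<-trans (n<1+n y) (n<1+n (suc y)))
  ... | no x≮  | yes y< = ⊥-elim (x≮ (<-trans x<y y<))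
  ... | no x≮  | no y≮  rewrite embed-Z (≮⇒≥ x≮) | embed-Z (≮⇒≥ y≮) = s≤s (s≤s x<y)
  retract-closed : ∀ u → u < N' → retract u < N
  retract-closed u u< with kind u u<
  ... | embedded x x< refl = subst (_< N) (sym (retract-embed x x<)) x<
  ... | inserted I with Inserted.retract-to I
  ...   | inj₁ eq = subst (_< N) (sym eq) pR<N
  ...   | inj₂ eq = subst (_< N) (sym eq) (≤-trans (s≤s z≤n) pR<N)
  to-embedded : ∀ u → u < N' → R' u (embed (retract u))
  to-embedded u u< with kind u u<
  ... | embedded x x< refl = reach-≡ (cong embed (sym (retract-embed x x<)))
  ... | inserted I = Inserted.path I
  embedded-≤ : ∀ u → u < N' → embed (retract u) ≤ u
  embedded-≤ u u< with kind u u<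
  ... | embedded x x< refl = ≤-reflexive (cong embed (retract-embed x x<))
  ... | inserted I = <⇒≤ (Inserted.above I)

  surgery : Surgery N α ε N' α' ε'
  surgery = record
    { embed          = embed
    ; embed-closed   = embed-closed
    ; embed-mono     = embed-mono
    ; embed-α        = embed-α
    ; embed-ε        = λ x x< → here ▸ε ε'-embed x x<
    ; detached       = λ _ → false
    ; detached-embed = λ _ _ → refl
    ; detached-α     = λ _ _ ()
    ; detached-ε     = λ _ _ ()
    ; retract        = retract
    ; retract-closed = λ u u< _ → retract-closed u u<
    ; retract-α      = λ u u< _ → retract-α u u<
    ; retract-ε      = λ u u< _ → retract-ε u u<
    ; retract-embed  = retract-embed
    ; to-embedded    = λ u u< _ → to-embedded u u<
    ; embedded-≤     = λ u u< _ → embedded-≤ u u< }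

  module Thm = SurgeryTheorem matchings matchings' surgery

  orbitMin orbitMin' : ℕ → Bool
  orbitMin  = orbitMinB N α ε
  orbitMin' = orbitMinB N' α' ε'

  inserted-not-min : ∀ {u} → Inserted u → orbitMin' u ≡ false
  inserted-not-min {u} I = Thm.orbitMinB-above-embedded u (Inserted.bound I) refl (Inserted.above I)

  private
    N≡ : ∀ q z → 2 * suc (q + z) ≡ 2 * suc q + 2 * z
    N≡ = solve-∀
    N'≡ : ∀ q z → 2 * suc (suc (suc (suc (suc (q + z))))) ≡ 2 * suc q + (2 + (2 * z + 6))
    N'≡ = solve-∀
    shift-2 : ∀ q k → 2 * suc q + (2 + k) ≡ 2 + (2 * suc q + k)
    shift-2 = solve-∀
    handle-corner : ∀ q z k → 2 * suc q + (2 + (2 * z + k)) ≡ k + 2 * suc (suc (q + z))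
    handle-corner = solve-∀

  count-P : count orbitMin' (upTo a₁L) ≡ count orbitMin (upTo a₁L)
  count-P = count-applyUpTo-cong orbitMin' orbitMin (λ k → k) (λ k → k) a₁L
    (λ k k< → trans (cong orbitMin' (sym (embed-P k<))) (Thm.orbitMinB-embed k (<-≤-trans k< a₁L≤N)))

  count-a₁ : count orbitMin' (applyUpTo (a₁L +_) 2) ≡ 0
  count-a₁ = count-applyUpTo-none orbitMin' (a₁L +_) 2 λ
    { 0 _ → trans (cong orbitMin' (+-identityʳ a₁L)) (inserted-not-min inserted-a₁L)
    ; 1 _ → trans (cong orbitMin' (+-comm a₁L 1)) (trans (cong orbitMin' (+-comm 1 a₁L)) (inserted-not-min inserted-a₁R))
    ; (suc (suc _)) (s≤s (s≤s ())) }

  count-Z : count orbitMin' (applyUpTo (λ k → a₁L + (2 + k)) (2 * z)) ≡ count orbitMin (applyUpTo (a₁L +_) (2 * z))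
  count-Z = count-applyUpTo-cong orbitMin' orbitMin (λ k → a₁L + (2 + k)) (a₁L +_) (2 * z) λ k k< →
    trans (cong orbitMin' (trans (shift-2 q k) (sym (embed-Z (m≤m+n a₁L k)))))
          (Thm.orbitMinB-embed (a₁L + k) (subst (a₁L + k <_) (sym (N≡ q z)) (+-monoʳ-< a₁L k<)))

  count-handle : count orbitMin' (applyUpTo (λ k → a₁L + (2 + (2 * z + k))) 6) ≡ 0
  count-handle = count-applyUpTo-none orbitMin' (λ k → a₁L + (2 + (2 * z + k))) 6 λ k k< →
    trans (cong orbitMin' (handle-corner q z k)) (corner-not-min k k<)
    where
    corner-not-min : ∀ k → k < 6 → orbitMin' (k + b₁L) ≡ false
    corner-not-min 0 _ = inserted-not-min inserted-b₁L
    corner-not-min 1 _ = trans (cong orbitMin' (+-comm 1 b₁L)) (inserted-not-min inserted-b₁R)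
    corner-not-min 2 _ = trans (cong orbitMin' (sym (*-suc 2 b₁))) (inserted-not-min inserted-a₂L)
    corner-not-min 3 _ = trans (cong orbitMin' (trans (cong suc (sym (*-suc 2 b₁))) (+-comm 1 a₂L))) (inserted-not-min inserted-a₂R)
    corner-not-min 4 _ = trans (cong orbitMin' (trans (cong (2 +_) (sym (*-suc 2 b₁))) (sym (*-suc 2 a₂)))) (inserted-not-min inserted-b₂L)
    corner-not-min 5 _ = trans (cong orbitMin' (trans (cong (λ k → suc (2 + k)) (sym (*-suc 2 b₁)))
                       (trans (cong suc (sym (*-suc 2 a₂))) (+-comm 1 b₂L)))) (inserted-not-min inserted-b₂R)
    corner-not-min (suc (suc (suc (suc (suc (suc _)))))) (s≤s (s≤s (s≤s (s≤s (s≤s (s≤s ()))))))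

  boundaryComponents-insert : boundaryComponents ρ' ≡ boundaryComponents ρ
  boundaryComponents-insert = begin
    boundaryComponents ρ'
      ≡⟨ trans (boundaryComponents≡orbits e (P ++ pos a ∷ Z ++ handleTail a b))
               (cong (λ k → count (orbitMinB (2 * suc k) (arcStep k) ε') (upTo (2 * suc k))) (suc-injective length-ρ')) ⟩
    count orbitMin' (upTo N')
      ≡⟨ cong (count orbitMin' ∘ upTo) (N'≡ q z) ⟩
    count orbitMin' (upTo (a₁L + (2 + (2 * z + 6))))
      ≡⟨ count-applyUpTo-+ orbitMin' (λ k → k) a₁L _ ⟩
    count orbitMin' (upTo a₁L) + count orbitMin' (applyUpTo (a₁L +_) (2 + (2 * z + 6)))
      ≡⟨ cong (count orbitMin' (upTo a₁L) +_) (trans (count-applyUpTo-+ orbitMin' (a₁L +_) 2 _)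
           (cong (count orbitMin' (applyUpTo (a₁L +_) 2) +_) (count-applyUpTo-+ orbitMin' (λ k → a₁L + (2 + k)) (2 * z) 6))) ⟩
    count orbitMin' (upTo a₁L) + (count orbitMin' (applyUpTo (a₁L +_) 2)
      + (count orbitMin' (applyUpTo (λ k → a₁L + (2 + k)) (2 * z))
         + count orbitMin' (applyUpTo (λ k → a₁L + (2 + (2 * z + k))) 6)))
      ≡⟨ cong₂ _+_ count-P (cong₂ _+_ count-a₁ (cong₂ _+_ count-Z count-handle)) ⟩
    count orbitMin (upTo a₁L) + (count orbitMin (applyUpTo (a₁L +_) (2 * z)) + 0)
      ≡⟨ cong (count orbitMin (upTo a₁L) +_) (+-identityʳ _) ⟩
    count orbitMin (upTo a₁L) + count orbitMin (applyUpTo (a₁L +_) (2 * z))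
      ≡⟨ sym (count-applyUpTo-+ orbitMin (λ k → k) a₁L (2 * z)) ⟩
    count orbitMin (upTo (a₁L + 2 * z))
      ≡⟨ cong (count orbitMin ∘ upTo) (sym (N≡ q z)) ⟩
    count orbitMin (upTo N)
      ≡⟨ sym (trans (boundaryComponents≡orbits e (P ++ Z))
                    (cong (λ k → count (orbitMinB (2 * suc k) (arcStep k) ε) (upTo (2 * suc k))) (length-++ P))) ⟩
    boundaryComponents ρ ∎
    where open ≡-Reasoning

  insertHandle : boundaryComponents ρ' ≡ boundaryComponents ρ × IsPairing ρ'
  insertHandle = boundaryComponents-insert , pairing'

isMatchingB : ℕ → (ℕ → ℕ) → Bool
isMatchingB N f = allB (λ p → (f p <ᵇ N) ∧ (not (f p ≡ᵇ p) ∧ (f (f p) ≡ᵇ p))) (upTo N)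

isMatchingB-sound : ∀ N f → isMatchingB N f ≡ true → IsMatching N f
isMatchingB-sound N f h = record
  { closed       = λ p p< → <ᵇ⇒< _ _ (≡true⇒T (proj₁ (tests p p<)))
  ; fixpointFree = λ p p< → ≡ᵇ≡false⇒≢ (proj₁ (proj₂ (tests p p<)))
  ; involutive   = λ p p< → ≡ᵇ≡true⇒≡ (proj₂ (proj₂ (tests p p<))) }
  where
  tests : ∀ p → p < N → (f p <ᵇ N) ≡ true × (f p ≡ᵇ p) ≡ false × (f (f p) ≡ᵇ p) ≡ true
  tests p p< with f p <ᵇ N | f p ≡ᵇ p | f (f p) ≡ᵇ p | allB-elim _ (λ z → z) N h p p<
  ... | true  | false | true  | _ = refl , refl , refl
  ... | false | _     | _     | ()
  ... | true  | true  | _     | ()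
  ... | true  | false | false | ()

IsMatching-cong : ∀ {N f g} → (∀ p → p < N → f p ≡ g p) → IsMatching N f → IsMatching N g
IsMatching-cong {N} {f} {g} f≗g M = record
  { closed       = λ p p< → subst (_< N) (f≗g p p<) (closed p p<)
  ; involutive   = λ p p< → trans (cong g (sym (f≗g p p<)))
                                  (trans (sym (f≗g (f p) (closed p p<))) (involutive p p<))
  ; fixpointFree = λ p p< eq → fixpointFree p p< (trans (f≗g p p<) eq) }
  where open IsMatching M

-- A conjunction that reduces to concrete conjuncts, so that `rewrite` reaches all of them.
Below : ℕ → (ℕ → Set) → Set
Below zero    P = ⊤
Below (suc n) P = P 0 × Below n (P ∘ suc)

Below-elim : ∀ n {P} → Below n P → ∀ k → k < n → P k
Below-elim (suc n) (P0 , _)    zero    _         = P0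
Below-elim (suc n) (_  , rest) (suc k) (s≤s k<n) = Below-elim n rest k k<n

loop : ℕ → Rotation
loop a = pos a ∷ pos a ∷ []

handle₄ : ℕ → ℕ → Rotation
handle₄ a b = pos a ∷ pos b ∷ pos a ∷ pos b ∷ []

boundaryComponents-loop : ∀ a → boundaryComponents (loop a) ≡ 2
boundaryComponents-loop a rewrite ≡⇒≡ᵇ≡true {a} refl = refl

isPairing-loop : ∀ a → IsPairing (loop a)
isPairing-loop a = IsMatching-cong (Below-elim 2 partners) (isMatchingB-sound 2 other refl)
  where
  other : ℕ → ℕ
  other p = (p + 1) % 2
  partners : Below 2 (λ p → other p ≡ partner (loop a) p)
  partners rewrite ≡⇒≡ᵇ≡true {a} refl = refl , refl , tt

boundaryComponents-handle₄ : ∀ a b → a ≢ b → boundaryComponents (handle₄ a b) ≡ 1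
boundaryComponents-handle₄ a b a≢b =
  count-applyUpTo-cong (isLeast (handle₄ a b) 3) (_≡ᵇ 0) (λ k → k) (λ k → k) 8 (Below-elim 8 corners)
  where
  corners : Below 8 (λ k → isLeast (handle₄ a b) 3 k ≡ (k ≡ᵇ 0))
  corners rewrite ≡⇒≡ᵇ≡true {a} refl | ≡⇒≡ᵇ≡true {b} refl | ≢⇒≡ᵇ≡false a≢b =
    refl , refl , refl , refl , refl , refl , refl , refl , tt

isPairing-handle₄ : ∀ a b → a ≢ b → IsPairing (handle₄ a b)
isPairing-handle₄ a b a≢b = IsMatching-cong (Below-elim 4 partners) (isMatchingB-sound 4 opposite refl)
  where
  opposite : ℕ → ℕ
  opposite p = (p + 2) % 4
  partners : Below 4 (λ p → opposite p ≡ partner (handle₄ a b) p)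
  partners rewrite ≡⇒≡ᵇ≡true {a} refl | ≡⇒≡ᵇ≡true {b} refl | ≢⇒≡ᵇ≡false a≢b | ≢⇒≡ᵇ≡false (a≢b ∘ sym) =
    refl , refl , refl , refl , tt

restrict-∷ : ∀ F x xs → restrict F (x ∷ xs) ≡ (if inSubset F (proj₂ x) then x ∷ restrict F xs else restrict F xs)
restrict-∷ F x xs with inSubset F (proj₂ x)
... | true  = refl
... | false = refl

restrict-++ : ∀ F xs ys → restrict F (xs ++ ys) ≡ restrict F xs ++ restrict F ys
restrict-++ F = filter-++ _

restrict-cong : ∀ F F' xs → All (λ e → inSubset F (proj₂ e) ≡ inSubset F' (proj₂ e)) xs → restrict F xs ≡ restrict F' xs
restrict-cong F F' []       []       = refl
restrict-cong F F' (x ∷ xs) (h ∷ hs) rewrite restrict-∷ F x xs | restrict-∷ F' x xs | h =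
  cong (λ r → if inSubset F' (proj₂ x) then x ∷ r else r) (restrict-cong F F' xs hs)

All-restrict : ∀ {P : End → Set} F xs → All P xs → All P (restrict F xs)
All-restrict F xs = filter⁺ (λ e → inSubset F (proj₂ e) Bool.≟ true)

All-nth : ∀ {A : Set} {P : A → Set} (d : A) xs r → All P xs → r < length xs → P (nth d xs r)
All-nth d (x ∷ xs) zero    (p ∷ ps) _       = p
All-nth d (x ∷ xs) (suc r) (p ∷ ps) (s≤s h) = All-nth d xs r ps h

inSubset-++ : ∀ F H l → l ≤ length F → inSubset (F ++ H) l ≡ inSubset F l
inSubset-++ F H zero    _ = refl
inSubset-++ F H (suc i) h = nth-++ˡ false F H i h

inSubset-last : ∀ F x → inSubset (F ++ x ∷ []) (suc (length F)) ≡ x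
inSubset-last F x = trans (cong (nth false (F ++ x ∷ [])) (sym (+-identityʳ (length F)))) (nth-++ʳ false F (x ∷ []) 0)

LabelsAtMost : ℕ → Rotation → Set
LabelsAtMost K = All (λ e → proj₂ e ≤ K)

restrict-snoc : ∀ F x {K} → length F ≡ K → ∀ xs → LabelsAtMost K xs → restrict (F ++ x ∷ []) xs ≡ restrict F xs
restrict-snoc F x refl xs h = restrict-cong (F ++ x ∷ []) F xs (All.map (λ {e} le → inSubset-++ F (x ∷ []) (proj₂ e) le) h)

snoc-view : ∀ {A : Set} (xs : List A) n → length xs ≡ suc n →
            Σ (List A) λ ys → Σ A λ y → (xs ≡ ys ++ y ∷ []) × (length ys ≡ n)
snoc-view (x ∷ [])      zero    _ = [] , x , refl , refl
snoc-view (x ∷ x' ∷ xs) (suc n) h with snoc-view (x' ∷ xs) n (suc-injective h)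
... | ys , y , eq , len = x ∷ ys , y , cong (x ∷_) eq , cong suc len

count-map : ∀ {A B : Set} (P : B → Bool) (f : A → B) xs → count P (map f xs) ≡ count (P ∘ f) xs
count-map P f []       = refl
count-map P f (x ∷ xs) rewrite count-∷ P (f x) (map f xs) | count-∷ (P ∘ f) x xs with P (f x)
... | true  = cong suc (count-map P f xs)
... | false = count-map P f xs

count-subsets-suc : ∀ n (P : List Bool → Bool) →
  count P (subsets (suc n)) ≡ count (P ∘ (true ∷_)) (subsets n) + count (P ∘ (false ∷_)) (subsets n)
count-subsets-suc n P = trans (count-++ P (map (true ∷_) (subsets n)) _)
                              (cong₂ _+_ (count-map P (true ∷_) (subsets n)) (count-map P (false ∷_) (subsets n)))

count-subsets-cong : ∀ n (P Q : List Bool → Bool) → (∀ F → length F ≡ n → P F ≡ Q F) →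
                     count P (subsets n) ≡ count Q (subsets n)
count-subsets-cong zero    P Q h =
  trans (count-∷ P [] []) (trans (cong (λ b → if b then 1 else 0) (h [] refl)) (sym (count-∷ Q [] [])))
count-subsets-cong (suc n) P Q h = begin
  count P (subsets (suc n))                                           ≡⟨ count-subsets-suc n P ⟩
  count (P ∘ (true ∷_)) (subsets n) + count (P ∘ (false ∷_)) (subsets n)
    ≡⟨ cong₂ _+_ (count-subsets-cong n _ _ (λ F len → h (true ∷ F) (cong suc len)))
                 (count-subsets-cong n _ _ (λ F len → h (false ∷ F) (cong suc len))) ⟩
  count (Q ∘ (true ∷_)) (subsets n) + count (Q ∘ (false ∷_)) (subsets n) ≡⟨ sym (count-subsets-suc n Q) ⟩
  count Q (subsets (suc n))                                           ∎
  where open ≡-Reasoning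

count-subsets-none : ∀ n (P : List Bool → Bool) → (∀ F → length F ≡ n → P F ≡ false) → count P (subsets n) ≡ 0
count-subsets-none n P h = trans (count-subsets-cong n P (λ _ → false) h) (none n)
  where
  none : ∀ n → count (λ _ → false) (subsets n) ≡ 0
  none zero    = refl
  none (suc n) = trans (count-subsets-suc n (λ _ → false)) (cong₂ _+_ (none n) (none n))

+-interchange : ∀ a b c d → (a + b) + (c + d) ≡ (a + c) + (b + d)
+-interchange = solve-∀

count-subsets-snoc : ∀ n (P : List Bool → Bool) → count P (subsets (suc n)) ≡
  count (λ F → P (F ++ true ∷ [])) (subsets n) + count (λ F → P (F ++ false ∷ [])) (subsets n)
count-subsets-snoc zero    P = trans (count-subsets-suc 0 P)
  (cong₂ _+_ (count-subsets-cong 0 (P ∘ (true ∷_)) (λ F → P (F ++ true ∷ [])) λ { [] _ → refl })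
             (count-subsets-cong 0 (P ∘ (false ∷_)) (λ F → P (F ++ false ∷ [])) λ { [] _ → refl }))
count-subsets-snoc (suc n) P = begin
  count P (subsets (suc (suc n)))
    ≡⟨ count-subsets-suc (suc n) P ⟩
  count (P ∘ (true ∷_)) (subsets (suc n)) + count (P ∘ (false ∷_)) (subsets (suc n))
    ≡⟨ cong₂ _+_ (count-subsets-snoc n (P ∘ (true ∷_))) (count-subsets-snoc n (P ∘ (false ∷_))) ⟩
  (last-in true true + last-in true false) + (last-in false true + last-in false false)
    ≡⟨ +-interchange (last-in true true) (last-in true false) (last-in false true) (last-in false false) ⟩
  (last-in true true + last-in false true) + (last-in true false + last-in false false)
    ≡⟨ sym (cong₂ _+_ (count-subsets-suc n (λ F → P (F ++ true ∷ []))) (count-subsets-suc n (λ F → P (F ++ false ∷ [])))) ⟩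
  count (λ F → P (F ++ true ∷ [])) (subsets (suc n)) + count (λ F → P (F ++ false ∷ [])) (subsets (suc n)) ∎
  where
  open ≡-Reasoning
  last-in : Bool → Bool → ℕ
  last-in x y = count (λ F → P (x ∷ F ++ y ∷ [])) (subsets n)

fresh-above : ∀ {K c ρ} → LabelsAtMost K ρ → K < c → ∀ r → r < length ρ → labelAt ρ r ≢ c
fresh-above {ρ = ρ} h K<c r r< eq = <⇒≱ K<c (subst (_≤ _) eq (All-nth (true , 0) ρ r h r<))

append-loop : ∀ {K a} X → LabelsAtMost K X → K < a → IsPairing X →
  boundaryComponents (X ++ loop a) ≡ suc (boundaryComponents X) × IsPairing (X ++ loop a)
append-loop {a = a} []      _ _   _       = boundaryComponents-loop a , isPairing-loop a
append-loop {a = a} (e ∷ X) h K<a pairing = AppendLoop.appendLoop e X a pairing (fresh-above h K<a)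

insert-handle : ∀ {K a b} Ps Zs → LabelsAtMost K (Ps ++ Zs) → K < a → a < b → (Ps ≡ [] → Zs ≡ []) →
  IsPairing (Ps ++ Zs) →
  boundaryComponents (Ps ++ pos a ∷ Zs ++ handleTail a b) ≡ boundaryComponents (Ps ++ Zs) ×
  IsPairing (Ps ++ pos a ∷ Zs ++ handleTail a b)
insert-handle {a = a} {b} [] Zs _ _ a<b no-Z _ with no-Z refl
... | refl = boundaryComponents-handle₄ a b (<⇒≢ a<b) , isPairing-handle₄ a b (<⇒≢ a<b)
insert-handle (e ∷ Ps) Zs h K<a a<b _ pairing =
  InsertHandle.insertHandle e Ps Zs _ _ (<⇒≢ a<b) pairing (fresh-above h K<a) (fresh-above h (<-trans K<a a<b))

head₅ : Rotation
head₅ = neg 1 ∷ pos 2 ∷ pos 3 ∷ pos 2 ∷ pos 1 ∷ []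

core : ℕ → Rotation
core k = head₅ ++ middle (3 + k)

middle-suc : ∀ k → middle (4 + k) ≡ middle (3 + k) ++ pos (4 + k) ∷ pos (3 + k) ∷ []
middle-suc k = begin
  concatMap pair (upTo (suc k))                 ≡⟨ cong (concatMap pair) (sym (applyUpTo-∷ʳ (λ j → j) k)) ⟩
  concatMap pair (upTo k ++ k ∷ [])             ≡⟨ concatMap-++ pair (upTo k) (k ∷ []) ⟩
  middle (3 + k) ++ pair k ++ []                ≡⟨ cong (middle (3 + k) ++_) (++-identityʳ (pair k)) ⟩
  middle (3 + k) ++ pair k                      ≡⟨ cong₂ (λ u v → middle (3 + k) ++ pos u ∷ pos v ∷ []) (+-comm k 4) (+-comm k 3) ⟩
  middle (3 + k) ++ pos (4 + k) ∷ pos (3 + k) ∷ [] ∎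
  where
  open ≡-Reasoning
  pair : ℕ → Rotation
  pair j = pos (j + 4) ∷ pos (j + 3) ∷ []

F'1-core : ∀ k → F'1 (3 + k) ≡ core k ++ pos (3 + k) ∷ []
F'1-core k = sym (++-assoc head₅ (middle (3 + k)) _)

core-suc : ∀ k → core (suc k) ≡ core k ++ pos (4 + k) ∷ pos (3 + k) ∷ []
core-suc k = trans (cong (head₅ ++_) (middle-suc k)) (sym (++-assoc head₅ (middle (3 + k)) _))

F'1-core-suc : ∀ k → F'1 (4 + k) ≡ core k ++ pos (4 + k) ∷ pos (3 + k) ∷ pos (4 + k) ∷ []
F'1-core-suc k = begin
  F'1 (4 + k)                                               ≡⟨ F'1-core (suc k) ⟩
  core (suc k) ++ pos (4 + k) ∷ []                          ≡⟨ cong (_++ pos (4 + k) ∷ []) (core-suc k) ⟩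
  (core k ++ pos (4 + k) ∷ pos (3 + k) ∷ []) ++ pos (4 + k) ∷ [] ≡⟨ ++-assoc (core k) _ _ ⟩
  core k ++ pos (4 + k) ∷ pos (3 + k) ∷ pos (4 + k) ∷ []    ∎
  where open ≡-Reasoning

labels-core : ∀ k → LabelsAtMost (3 + k) (core k)
labels-core k = ++⁺ (s≤s z≤n ∷ s≤s (s≤s z≤n) ∷ s≤s (s≤s (s≤s z≤n)) ∷ s≤s (s≤s z≤n) ∷ s≤s z≤n ∷ []) (labels-middle k)
  where
  labels-middle : ∀ k → LabelsAtMost (3 + k) (middle (3 + k))
  labels-middle zero    = []
  labels-middle (suc k) = subst (LabelsAtMost (4 + k)) (sym (middle-suc k))
    (++⁺ (All.map (λ le → ≤-trans le (n≤1+n _)) (labels-middle k)) (≤-refl ∷ n≤1+n _ ∷ []))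

last-in-core : ∀ k → pos (3 + k) ∈ core k
last-in-core zero    = Any.there (Any.there (Any.here refl))
last-in-core (suc k) = subst (pos (4 + k) ∈_) (sym (core-suc k)) (∈-++⁺ʳ (core k) (Any.here refl))

restrict-[]-tail : ∀ G x xs → restrict G (x ∷ xs) ≡ [] → restrict G xs ≡ []
restrict-[]-tail G x xs h with inSubset G (proj₂ x) | restrict-∷ G x xs
... | false | eq = trans (sym eq) h
... | true  | eq with () ← trans (sym eq) h

restrict-[]⇒∉ : ∀ G {e} xs → restrict G xs ≡ [] → e ∈ xs → inSubset G (proj₂ e) ≡ false
restrict-[]⇒∉ G (x ∷ xs) h (Any.here refl) with inSubset G (proj₂ x) | restrict-∷ G x xs
... | false | _  = refl
... | true  | eq with () ← trans (sym eq) h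
restrict-[]⇒∉ G (x ∷ xs) h (Any.there e∈) = restrict-[]⇒∉ G xs (restrict-[]-tail G x xs h) e∈

restrict-none : ∀ G xs → All (λ e → inSubset G (proj₂ e) ≡ false) xs → restrict G xs ≡ []
restrict-none G []       []       = refl
restrict-none G (x ∷ xs) (h ∷ hs) rewrite restrict-∷ G x xs | h = restrict-none G xs hs

record Decomposition (k : ℕ) : Set where
  field
    P Z       : Rotation
    F'1-big   : F'1 (4 + k) ≡ P ++ pos (3 + k) ∷ Z ++ handleTail (3 + k) (4 + k)
    F'1-small : F'1 (2 + k) ≡ P ++ Z
    labels-P  : LabelsAtMost (2 + k) P
    labels-Z  : LabelsAtMost (2 + k) Z
    Z-needs-P : ∀ G → restrict G P ≡ [] → restrict G Z ≡ []

decomposition : ∀ k → Decomposition k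
decomposition zero = record
  { P = neg 1 ∷ pos 2 ∷ [] ; Z = pos 2 ∷ pos 1 ∷ [] ; F'1-big = refl ; F'1-small = refl
  ; labels-P = s≤s z≤n ∷ s≤s (s≤s z≤n) ∷ [] ; labels-Z = s≤s (s≤s z≤n) ∷ s≤s z≤n ∷ []
  ; Z-needs-P = λ G h → restrict-none G (pos 2 ∷ pos 1 ∷ [])
      (restrict-[]⇒∉ G (neg 1 ∷ pos 2 ∷ []) h (Any.there (Any.here refl))
       ∷ restrict-[]⇒∉ G (neg 1 ∷ pos 2 ∷ []) h (Any.here refl) ∷ []) }
decomposition (suc k) = record
  { P = core k ; Z = pos (3 + k) ∷ [] ; F'1-big = F'1-big ; F'1-small = F'1-core k
  ; labels-P = labels-core k ; labels-Z = ≤-refl ∷ []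
  ; Z-needs-P = λ G h → restrict-none G (pos (3 + k) ∷ []) (restrict-[]⇒∉ G (core k) h (last-in-core k) ∷ []) }
  where
  F'1-big : F'1 (5 + k) ≡ core k ++ pos (4 + k) ∷ pos (3 + k) ∷ handleTail (4 + k) (5 + k)
  F'1-big = trans (F'1-core-suc (suc k))
    (trans (cong (_++ pos (5 + k) ∷ pos (4 + k) ∷ pos (5 + k) ∷ []) (core-suc k)) (++-assoc (core k) _ _))

restrict-kept : ∀ F {l} xs → inSubset F l ≡ true → restrict F (pos l ∷ xs) ≡ pos l ∷ restrict F xs
restrict-kept F {l} xs h = trans (restrict-∷ F (pos l) xs) (cong (λ b → if b then pos l ∷ restrict F xs else restrict F xs) h)

restrict-dropped : ∀ F {l} xs → inSubset F l ≡ false → restrict F (pos l ∷ xs) ≡ restrict F xs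
restrict-dropped F {l} xs h = trans (restrict-∷ F (pos l) xs) (cong (λ b → if b then pos l ∷ restrict F xs else restrict F xs) h)

inSubset-snoc-old : ∀ F x {K l} → length F ≡ K → l ≤ K → inSubset (F ++ x ∷ []) l ≡ inSubset F l
inSubset-snoc-old F x refl l≤ = inSubset-++ F (x ∷ []) _ l≤

inSubset-snoc-new : ∀ F x {K} → length F ≡ K → inSubset (F ++ x ∷ []) (suc K) ≡ x
inSubset-snoc-new F x refl = inSubset-last F x

length-snoc : ∀ F (x : Bool) {K} → length F ≡ K → length (F ++ x ∷ []) ≡ suc K
length-snoc F x refl = trans (length-++ F) (+-comm (length F) 1)

restrict-last-absent : ∀ k F → length F ≡ 3 + k → restrict (F ++ false ∷ []) (F'1 (4 + k)) ≡ restrict F (F'1 (3 + k))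
restrict-last-absent k F length-F = begin
  restrict F' (F'1 (4 + k))
    ≡⟨ cong (restrict F') (F'1-core-suc k) ⟩
  restrict F' (core k ++ pos (4 + k) ∷ pos (3 + k) ∷ pos (4 + k) ∷ [])
    ≡⟨ restrict-++ F' (core k) _ ⟩
  restrict F' (core k) ++ restrict F' (pos (4 + k) ∷ pos (3 + k) ∷ pos (4 + k) ∷ [])
    ≡⟨ cong₂ _++_ (restrict-snoc F false length-F (core k) (labels-core k)) tail ⟩
  restrict F (core k) ++ restrict F (pos (3 + k) ∷ [])
    ≡⟨ sym (restrict-++ F (core k) _) ⟩
  restrict F (core k ++ pos (3 + k) ∷ [])
    ≡⟨ cong (restrict F) (sym (F'1-core k)) ⟩
  restrict F (F'1 (3 + k)) ∎
  where
  open ≡-Reasoning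
  F' = F ++ false ∷ []
  absent : inSubset F' (4 + k) ≡ false
  absent = inSubset-snoc-new F false length-F
  tail : restrict F' (pos (4 + k) ∷ pos (3 + k) ∷ pos (4 + k) ∷ []) ≡ restrict F (pos (3 + k) ∷ [])
  tail rewrite restrict-dropped F' (pos (3 + k) ∷ pos (4 + k) ∷ []) absent
             | restrict-∷ F' (pos (3 + k)) (pos (4 + k) ∷ []) | inSubset-snoc-old F false length-F (≤-refl {3 + k})
             | restrict-dropped F' [] absent | restrict-∷ F (pos (3 + k)) [] = refl

module LastTwoEdges (k : ℕ) (G : List Bool) (length-G : length G ≡ 2 + k) where
  open Decomposition (decomposition k)

  extend : Bool → List Bool
  extend x = (G ++ x ∷ []) ++ true ∷ []

  restrict-extend-old : ∀ x ρ → LabelsAtMost (2 + k) ρ → restrict (extend x) ρ ≡ restrict G ρ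
  restrict-extend-old x ρ h =
    trans (restrict-snoc (G ++ x ∷ []) true (length-snoc G x length-G) ρ (All.map (λ le → ≤-trans le (n≤1+n _)) h))
          (restrict-snoc G x length-G ρ h)

  in-extend-a : ∀ x → inSubset (extend x) (3 + k) ≡ x
  in-extend-a x = trans (inSubset-snoc-old (G ++ x ∷ []) true (length-snoc G x length-G) ≤-refl)
                        (inSubset-snoc-new G x length-G)

  in-extend-b : ∀ x → inSubset (extend x) (4 + k) ≡ true
  in-extend-b x = inSubset-snoc-new (G ++ x ∷ []) true (length-snoc G x length-G)

  restrict-small : restrict G (F'1 (2 + k)) ≡ restrict G P ++ restrict G Z
  restrict-small = trans (cong (restrict G) F'1-small) (restrict-++ G P Z)

  restrict-absent : restrict (extend false) (F'1 (4 + k)) ≡ restrict G (F'1 (2 + k)) ++ loop (4 + k)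
  restrict-absent = begin
    restrict (extend false) (F'1 (4 + k))
      ≡⟨ cong (restrict (extend false)) F'1-big ⟩
    restrict (extend false) (P ++ pos (3 + k) ∷ Z ++ handleTail (3 + k) (4 + k))
      ≡⟨ trans (restrict-++ (extend false) P _) (cong (restrict (extend false) P ++_) (restrict-dropped (extend false) _ (in-extend-a false))) ⟩
    restrict (extend false) P ++ restrict (extend false) (Z ++ handleTail (3 + k) (4 + k))
      ≡⟨ cong (restrict (extend false) P ++_) (restrict-++ (extend false) Z _) ⟩
    restrict (extend false) P ++ restrict (extend false) Z ++ restrict (extend false) (handleTail (3 + k) (4 + k))
      ≡⟨ cong₂ (λ u v → u ++ v ++ restrict (extend false) (handleTail (3 + k) (4 + k)))
               (restrict-extend-old false P labels-P) (restrict-extend-old false Z labels-Z) ⟩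
    restrict G P ++ restrict G Z ++ restrict (extend false) (handleTail (3 + k) (4 + k))
      ≡⟨ cong (λ t → restrict G P ++ restrict G Z ++ t) handle-without-a ⟩
    restrict G P ++ restrict G Z ++ loop (4 + k)
      ≡⟨ sym (++-assoc (restrict G P) _ _) ⟩
    (restrict G P ++ restrict G Z) ++ loop (4 + k)
      ≡⟨ cong (_++ loop (4 + k)) (sym restrict-small) ⟩
    restrict G (F'1 (2 + k)) ++ loop (4 + k) ∎
    where
    open ≡-Reasoning
    handle-without-a : restrict (extend false) (handleTail (3 + k) (4 + k)) ≡ loop (4 + k)
    handle-without-a rewrite restrict-kept (extend false) (pos (3 + k) ∷ pos (4 + k) ∷ []) (in-extend-b false)
                           | restrict-dropped (extend false) (pos (4 + k) ∷ []) (in-extend-a false)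
                           | restrict-kept (extend false) [] (in-extend-b false) = refl

  restrict-present : restrict (extend true) (F'1 (4 + k)) ≡
                     restrict G P ++ pos (3 + k) ∷ restrict G Z ++ handleTail (3 + k) (4 + k)
  restrict-present = begin
    restrict (extend true) (F'1 (4 + k))
      ≡⟨ cong (restrict (extend true)) F'1-big ⟩
    restrict (extend true) (P ++ pos (3 + k) ∷ Z ++ handleTail (3 + k) (4 + k))
      ≡⟨ trans (restrict-++ (extend true) P _) (cong (restrict (extend true) P ++_) (restrict-kept (extend true) _ (in-extend-a true))) ⟩
    restrict (extend true) P ++ pos (3 + k) ∷ restrict (extend true) (Z ++ handleTail (3 + k) (4 + k))
      ≡⟨ cong (λ t → restrict (extend true) P ++ pos (3 + k) ∷ t) (restrict-++ (extend true) Z _) ⟩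
    restrict (extend true) P ++ pos (3 + k) ∷ restrict (extend true) Z ++ restrict (extend true) (handleTail (3 + k) (4 + k))
      ≡⟨ cong₂ (λ u v → u ++ pos (3 + k) ∷ v ++ restrict (extend true) (handleTail (3 + k) (4 + k)))
               (restrict-extend-old true P labels-P) (restrict-extend-old true Z labels-Z) ⟩
    restrict G P ++ pos (3 + k) ∷ restrict G Z ++ restrict (extend true) (handleTail (3 + k) (4 + k))
      ≡⟨ cong (λ t → restrict G P ++ pos (3 + k) ∷ restrict G Z ++ t) handle-kept ⟩
    restrict G P ++ pos (3 + k) ∷ restrict G Z ++ handleTail (3 + k) (4 + k) ∎
    where
    open ≡-Reasoning
    handle-kept : restrict (extend true) (handleTail (3 + k) (4 + k)) ≡ handleTail (3 + k) (4 + k)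
    handle-kept rewrite restrict-kept (extend true) (pos (3 + k) ∷ pos (4 + k) ∷ []) (in-extend-b true)
                      | restrict-kept (extend true) (pos (4 + k) ∷ []) (in-extend-a true)
                      | restrict-kept (extend true) [] (in-extend-b true) = refl

  module _ (pairing : IsPairing (restrict G (F'1 (2 + k)))) where

    labels-small : LabelsAtMost (2 + k) (restrict G (F'1 (2 + k)))
    labels-small = All-restrict G _ (subst (LabelsAtMost (2 + k)) (sym F'1-small) (++⁺ labels-P labels-Z))

    without-a : boundaryComponents (restrict (extend false) (F'1 (4 + k))) ≡ suc (boundaryComponents (restrict G (F'1 (2 + k))))
              × IsPairing (restrict (extend false) (F'1 (4 + k)))
    without-a with append-loop (restrict G (F'1 (2 + k))) labels-small (≤-trans (n<1+n (2 + k)) (n≤1+n (3 + k))) pairing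
    ... | bc , p = trans (cong boundaryComponents restrict-absent) bc , subst IsPairing (sym restrict-absent) p

    with-a : boundaryComponents (restrict (extend true) (F'1 (4 + k))) ≡ boundaryComponents (restrict G (F'1 (2 + k)))
           × IsPairing (restrict (extend true) (F'1 (4 + k)))
    with-a with insert-handle (restrict G P) (restrict G Z) (subst (LabelsAtMost (2 + k)) restrict-small labels-small)
                  (n<1+n (2 + k)) (n<1+n (3 + k)) (Z-needs-P G) (subst IsPairing restrict-small pairing)
    ... | bc , p = trans (cong boundaryComponents restrict-present) (trans bc (cong boundaryComponents (sym restrict-small))) ,
                   subst IsPairing (sym restrict-present) p

-- The recurrence

PairingsOf : ℕ → Set
PairingsOf n = ∀ F → length F ≡ n → IsPairing (restrict F (F'1 n))

pairings-step : ∀ k → PairingsOf (2 + k) → PairingsOf (3 + k) → PairingsOf (4 + k)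
pairings-step k pairings₂ pairings₃ F length-F with snoc-view F (3 + k) length-F
... | F₁ , false , refl , length-F₁ = subst IsPairing (sym (restrict-last-absent k F₁ length-F₁)) (pairings₃ F₁ length-F₁)
... | F₁ , true  , refl , length-F₁ with snoc-view F₁ (2 + k) length-F₁
...   | G , false , refl , length-G = proj₂ (LastTwoEdges.without-a k G length-G (pairings₂ G length-G))
...   | G , true  , refl , length-G = proj₂ (LastTwoEdges.with-a k G length-G (pairings₂ G length-G))

pairings : ∀ k → PairingsOf (2 + k) × PairingsOf (3 + k)
pairings zero = (λ { (x ∷ y ∷ []) _ → by-computation (restrict (x ∷ y ∷ []) (F'1 2)) (two x y) })
              , (λ { (x ∷ y ∷ w ∷ []) _ → by-computation (restrict (x ∷ y ∷ w ∷ []) (F'1 3)) (three x y w) })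
  where
  by-computation : ∀ ρ → isMatchingB (length ρ) (partner ρ) ≡ true → IsPairing ρ
  by-computation ρ = isMatchingB-sound (length ρ) (partner ρ)
  two : ∀ x y → let ρ = restrict (x ∷ y ∷ []) (F'1 2) in isMatchingB (length ρ) (partner ρ) ≡ true
  two true  true  = refl
  two true  false = refl
  two false true  = refl
  two false false = refl
  three : ∀ x y w → let ρ = restrict (x ∷ y ∷ w ∷ []) (F'1 3) in isMatchingB (length ρ) (partner ρ) ≡ true
  three true  true  true  = refl
  three true  true  false = refl
  three true  false true  = refl
  three true  false false = refl
  three false true  true  = refl
  three false true  false = refl
  three false false true  = refl
  three false false false = refl
pairings (suc k) with pairings k
... | pairings₂ , pairings₃ = pairings₃ , pairings-step k pairings₂ pairings₃

boundaryComponents-pos : ∀ ρ → 1 ≤ boundaryComponents ρ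
boundaryComponents-pos []      = s≤s z≤n
boundaryComponents-pos (e ∷ ρ)
  rewrite count-∷ (isLeast (e ∷ ρ) (length ρ)) 0 (applyUpTo suc (length ρ + suc (length ρ + 0)))
        | allB-intro (λ k → 0 ≤ᵇ walk (e ∷ ρ) (length ρ) 0 k) (λ z → z) (2 * suc (length ρ)) (λ _ _ → refl) = s≤s z≤n

not-quasiTree : ∀ ρ X → boundaryComponents ρ ≡ suc (boundaryComponents X) → isQuasiTree ρ ≡ false
not-quasiTree ρ X eq rewrite eq with boundaryComponents X | boundaryComponents-pos X
... | suc _ | _ = refl

κ-recurrence : ∀ k → PairingsOf (2 + k) →
               κ (4 + k) (F'1 (4 + k)) ≡ κ (3 + k) (F'1 (3 + k)) + κ (2 + k) (F'1 (2 + k))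
κ-recurrence k pairings₂ = begin
  count quasiTree₄ (subsets (4 + k))
    ≡⟨ count-subsets-snoc (3 + k) quasiTree₄ ⟩
  count (λ F → quasiTree₄ (F ++ true ∷ [])) (subsets (3 + k)) + count (λ F → quasiTree₄ (F ++ false ∷ [])) (subsets (3 + k))
    ≡⟨ +-comm (count (λ F → quasiTree₄ (F ++ true ∷ [])) (subsets (3 + k))) _ ⟩
  count (λ F → quasiTree₄ (F ++ false ∷ [])) (subsets (3 + k)) + count (λ F → quasiTree₄ (F ++ true ∷ [])) (subsets (3 + k))
    ≡⟨ cong₂ _+_ last-absent last-present ⟩
  κ (3 + k) (F'1 (3 + k)) + κ (2 + k) (F'1 (2 + k)) ∎
  where
  open ≡-Reasoning
  quasiTree₄ : List Bool → Bool
  quasiTree₄ F = isQuasiTree (restrict F (F'1 (4 + k)))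
  last-absent : count (λ F → quasiTree₄ (F ++ false ∷ [])) (subsets (3 + k)) ≡ κ (3 + k) (F'1 (3 + k))
  last-absent = count-subsets-cong (3 + k) _ _ (λ F len → cong isQuasiTree (restrict-last-absent k F len))
  -- Given edge 4 + k, dropping edge 3 + k leaves 4 + k a trivial loop, which splits off a boundary component.
  last-present : count (λ F → quasiTree₄ (F ++ true ∷ [])) (subsets (3 + k)) ≡ κ (2 + k) (F'1 (2 + k))
  last-present = begin
    count (λ F → quasiTree₄ (F ++ true ∷ [])) (subsets (3 + k))
      ≡⟨ count-subsets-snoc (2 + k) (λ F → quasiTree₄ (F ++ true ∷ [])) ⟩
    count (λ G → quasiTree₄ ((G ++ true ∷ []) ++ true ∷ [])) (subsets (2 + k))
      + count (λ G → quasiTree₄ ((G ++ false ∷ []) ++ true ∷ [])) (subsets (2 + k))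
      ≡⟨ cong₂ _+_ (count-subsets-cong (2 + k) _ _ λ G len →
                      cong (_≡ᵇ 1) (proj₁ (LastTwoEdges.with-a k G len (pairings₂ G len))))
                   (count-subsets-none (2 + k) _ λ G len →
                      not-quasiTree (restrict ((G ++ false ∷ []) ++ true ∷ []) (F'1 (4 + k))) (restrict G (F'1 (2 + k)))
                                    (proj₁ (LastTwoEdges.without-a k G len (pairings₂ G len)))) ⟩
    κ (2 + k) (F'1 (2 + k)) + 0
      ≡⟨ +-identityʳ _ ⟩
    κ (2 + k) (F'1 (2 + k)) ∎

fib+lucas : ℕ → ℕ
fib+lucas k = fib (2 + k) + lucas (1 + k)

fib+lucas-recurrence : ∀ k → fib+lucas (2 + k) ≡ fib+lucas (1 + k) + fib+lucas k
fib+lucas-recurrence k = +-interchange (fib (3 + k)) (fib (2 + k)) (lucas (2 + k)) (lucas (1 + k))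

κ-F'1 : ∀ k → κ (2 + k) (F'1 (2 + k)) ≡ fib+lucas k × κ (3 + k) (F'1 (3 + k)) ≡ fib+lucas (1 + k)
κ-F'1 zero    = refl , refl
κ-F'1 (suc k) with κ-F'1 k
... | κ₂ , κ₃ = κ₃ , (begin
  κ (4 + k) (F'1 (4 + k))                          ≡⟨ κ-recurrence k (proj₁ (pairings k)) ⟩
  κ (3 + k) (F'1 (3 + k)) + κ (2 + k) (F'1 (2 + k)) ≡⟨ cong₂ _+_ κ₃ κ₂ ⟩
  fib+lucas (1 + k) + fib+lucas k                  ≡⟨ sym (fib+lucas-recurrence k) ⟩
  fib+lucas (2 + k)                                ∎)
  where open ≡-Reasoning

theorem5p2 : (n : ℕ) → 2 ≤ n → κ n (F'1 n) ≡ fib n + lucas (n ∸ 1)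
theorem5p2 (suc (suc k)) _ = proj₁ (κ-F'1 k)
theorem5p2 (suc zero) (s≤s ())
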